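{- Consider a run of algorithm LMA on an Exponential Caching input all of whose requested sets have cardinality at most $r$, compared against an offline solution $\mathrm{OPT}$ with valid partitionings $p^*_0,p^*_1,\dots$. Fix a step $t$ with request $R_t$ and consider its first part, in which LMA processes $R_t$ completely (paying its access cost and the movement costs of all its fetch operations) while OPT keeps the partitioning $p^*=p^*_{t-1}$ and pays only its access cost $\Delta\mathrm{OPT}=\min_{x\in R_t}2^{p^*_{t-1}(x)}$. Then $$\mathbf E[\Delta\mathrm{LMA}+\Delta\Phi]\le(\alpha(r-1)+8)\cdot 2^{\kappa}\cdot\Delta\mathrm{OPT}=O(r^2)\cdot\Delta\mathrm{OPT},$$ where $\Delta\mathrm{LMA}$ is LMA's cost in this part, $\Delta\Phi$ the change of $\Phi=\sum_{u\in U}\Phi_u$ (computed with $p^*=p^*_{t-1}$) over this part, and the expectation is over LMA's random choices in this part, conditioned on the state at the beginning of the step.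
   Context: Exponential Caching: $|U|=2^w-1$; with $[w]=\{0,\dots,w-1\}$, a partitioning $p:U\to[w]$ is valid if $|p^{ -1}(i)|=2^i$; chunks $S_i=p^{ -1}(i)$. LMA maintains a valid partitioning $p$ and budgets $b(z)$, initially $0$. fetch$(z)$: if $\ell=p(z)>0$, for $i=0,\dots,\ell-1$ pick $a_i$ uniformly at random from $S_i$, then move $z$ from $S_\ell$ to $S_0$ and each $a_i$ from $S_i$ to $S_{i+1}$; in all cases set $b(z)\gets0$; the movement cost charged to it is $2^\ell+\sum_{i=0}^{\ell-1}2^{i+1}$ if $\ell>0$, and $0$ otherwise. On request $R$: let $x\in R$ minimize $p(x)$, $\ell=p(x)$ (at the time of the request); pay access cost $2^\ell$; execute fetch$(x)$; for each $y\in R\setminus\{x\}$ set $b(y)\gets b(y)+2^\ell$; then while some $z$ has $b(z)\ge 2^{p(z)}$, execute fetch$(z)$. Parameters and potential: $\alpha=7$, $\gamma=7r-6$, $\beta=21r-11$, $\kappa=\lceil\log_2\beta\rceil$; $\Phi_u=\alpha\,b(u)$ if $p(u)\le p^*(u)+\kappa$, and $\Phi_u=\beta\,2^{p(u)}-\gamma\,b(u)$ if $p(u)\ge p^*(u)+\kappa+1$. -}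

module Defs where

open import Data.Nat using (ℕ; zero; suc; _+_; _*_; _∸_; _^_; _≤_; _<_; _⊓_; _≟_; _≤?_)
open import Data.Nat.Logarithm using (⌈log₂_⌉)
open import Data.Integer as ℤ using (ℤ; +_)
open import Data.Rational as ℚ using (ℚ; _/_; 1ℚ; 0ℚ)
open import Data.Fin using (Fin)
import Data.Fin as F
open import Data.Fin.Properties using () renaming (_≟_ to _≟ᶠ_)
open import Data.List using (List; []; _∷_; length; filter; map; concatMap; foldr; sum; allFin; lookup)
import Data.List.Membership.DecPropositional as DecMem
open import Data.List.Membership.Propositional using (_∈_)
open import Data.List.Relation.Unary.Unique.Propositional using (Unique)
open import Data.Product using (Σ; _×_; _,_; proj₁; proj₂; ∃)
open import Data.Bool using (Bool; true; false; if_then_else_)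
open import Relation.Nullary using (Dec; yes; no; ¬_)
open import Relation.Nullary.Decidable using (⌊_⌋)
open import Relation.Binary.PropositionalEquality using (_≡_)

Dist : Set → Set
Dist A = List (ℚ × A)

return : ∀ {A : Set} → A → Dist A
return a = (1ℚ , a) ∷ []

_>>=_ : ∀ {A B : Set} → Dist A → (A → Dist B) → Dist B
d >>= f = concatMap (λ { (w , a) → map (λ { (v , b) → (w ℚ.* v , b) }) (f a) }) d

uniform : ∀ {A : Set} → List A → Dist A
uniform [] = []
uniform (a ∷ as) = map (λ x → (+ 1 / suc (length as) , x)) (a ∷ as)

𝔼 : ∀ {A : Set} → Dist A → (A → ℤ) → ℚ
𝔼 d f = foldr (λ { (w , a) acc → w ℚ.* (f a / 1) ℚ.+ acc }) 0ℚ d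

_∈supp_ : ∀ {A : Set} → A → Dist A → Set
a ∈supp d = ∃ λ w → (w , a) ∈ d

module LMA (w : ℕ) where

  open DecMem (_≟ᶠ_ {2 ^ w ∸ 1}) using () renaming (_∈?_ to _∈?ᶠ_)

  U : Set
  U = Fin (2 ^ w ∸ 1)

  Partitioning : Set
  Partitioning = U → ℕ

  chunk : Partitioning → ℕ → List (U)
  chunk p i = filter (λ u → p u ≟ i) (allFin _)

  Valid : Partitioning → Set
  Valid p = (∀ u → p u < w) × (∀ i → i < w → length (chunk p i) ≡ 2 ^ i)

  State : Set
  State = Partitioning × (U → ℕ)

  part : State → Partitioning
  part = proj₁

  budget : State → U → ℕ
  budget = proj₂

  update : ∀ {A : Set} → (U → A) → U → A → U → A
  update f z a u = if ⌊ u ≟ᶠ z ⌋ then a else f u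

  choices : Partitioning → ℕ → Dist (List (U))
  choices p zero = return []
  choices p (suc k) = choices p k >>= λ as → uniform (chunk p k) >>= λ a → return (a ∷ as)

  -- movement cost of fetch(z) with ℓ = p(z): 2^ℓ + Σ_{i<ℓ} 2^{i+1} if ℓ>0, else 0
  sumPow : ℕ → ℕ
  sumPow zero = 0
  sumPow (suc i) = sumPow i + 2 ^ suc i

  moveCost : ℕ → ℕ
  moveCost zero = 0
  moveCost (suc ℓ) = 2 ^ suc ℓ + sumPow (suc ℓ)

  -- the new partitioning after fetch(z) with chosen elements as = (a_i)_{i<ℓ}:
  -- z goes to S_0, each a_i goes from S_i to S_{i+1}, others stay.
  -- (a_i ∈ S_i, so u = a_i for some i iff u ∈ as, and then i = p u.)
  movedPart : Partitioning → U → List (U) → Partitioning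
  movedPart p z as u =
    if ⌊ u ≟ᶠ z ⌋ then 0 else (if ⌊ u ∈?ᶠ as ⌋ then suc (p u) else p u)

  fetch : State → U → Dist (State × ℕ)
  fetch (p , b) z =
    choices p (p z) >>= λ as →
    return ((movedPart p z as , update b z 0) , moveCost (p z))

  violators : State → List (U)
  violators (p , b) = filter (λ z → 2 ^ p z ≤? b z) (allFin _)

  -- A rule choosing which violator to fetch next: given the current state and
  -- the number k+1 of violators, it returns an index into the list of violators.
  Selector : Set
  Selector = State → (k : ℕ) → Fin (suc k)

  -- the while loop, with fuel; fuel |U| suffices since every fetch(z) strictly
  -- decreases the set of violators.
  loop : Selector → ℕ → State → Dist (State × ℕ)
  loop sel zero s = return (s , 0)
  loop sel (suc fuel) s with violators s
  ... | [] = return (s , 0)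
  ... | v ∷ vs =
    fetch s (lookup (v ∷ vs) (sel s (length vs))) >>= λ { (s₁ , c₁) →
    loop sel fuel s₁ >>= λ { (s₂ , c₂) → return (s₂ , c₁ + c₂) } }

  addBudgets : List (U) → U → ℕ → (U → ℕ) → U → ℕ
  addBudgets R x a b u =
    if ⌊ u ∈?ᶠ R ⌋ ∧' not' ⌊ u ≟ᶠ x ⌋ then b u + a else b u
    where
    _∧'_ : Bool → Bool → Bool
    true ∧' c = c
    false ∧' c = false
    not' : Bool → Bool
    not' true = false
    not' false = true

  process : Selector → State → List (U) → U → Dist (State × ℕ)
  process sel (p , b) R x =
    fetch (p , b) x >>= λ { ((p₁ , b₁) , c₁) →
    loop sel (2 ^ w ∸ 1) (p₁ , addBudgets R x (2 ^ p x) b₁) >>= λ { (s₂ , c₂) →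
    return (s₂ , 2 ^ p x + c₁ + c₂) } }

  IsMinimizer : Partitioning → List (U) → U → Set
  IsMinimizer p R x = x ∈ R × (∀ y → y ∈ R → p x ≤ p y)

  Request : ℕ → List (U) → Set
  Request r R = Unique R × (¬ R ≡ []) × length R ≤ r

  data Reachable (r : ℕ) : State → Set where
    init : ∀ p → Valid p → Reachable r (p , λ _ → 0)
    step : ∀ s R x (sel : Selector) s' c →
           Reachable r s → Request r R → IsMinimizer (part s) R x →
           (s' , c) ∈supp process sel s R x → Reachable r s'

  α : ℕ
  α = 7

  γ : ℕ → ℕ
  γ r = 7 * r ∸ 6

  β : ℕ → ℕ
  β r = 21 * r ∸ 11

  κ : ℕ → ℕ
  κ r = ⌈log₂ β r ⌉

  Φᵤ : ℕ → Partitioning → State → U → ℤ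
  Φᵤ r p* (p , b) u with p u ≤? p* u + κ r
  ... | yes _ = + (α * b u)
  ... | no _  = + (β r * 2 ^ p u) ℤ.- + (γ r * b u)

  Φ : ℕ → Partitioning → State → ℤ
  Φ r p* s = foldr (λ u acc → Φᵤ r p* s u ℤ.+ acc) (+ 0) (allFin _)

  optAccess : Partitioning → List (U) → ℕ
  optAccess p* [] = 0
  optAccess p* (u ∷ us) = foldr (λ v m → 2 ^ p* v ⊓ m) (2 ^ p* u) us

  List' : Set
  List' = List (U)

-- A fetch of z moves z to S₀ and one uniformly random aᵢ ∈ Sᵢ to Sᵢ₊₁ for each i < ℓ = p(z).
-- Such a move can raise Φ_{aᵢ} only if aᵢ ends up more than κ chunks below its chunk in p*;
-- fewer than 2^{i+1-κ} elements qualify and each gains at most β 2^{i+1} ≤ 2^{κ+i+1}, so the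
-- expected gain per level is at most 4·2ⁱ. With the movement cost this bounds the expected
-- amortized cost of fetch(z) by 7·2^ℓ - Φ_z. Inside the loop every fetched z has
-- 2^ℓ ≤ b(z) < 2·2^ℓ, which forces Φ_z ≥ 7·2^ℓ, so the loop has non-positive expected amortized
-- cost. For the request itself, with X = 2^{p(x)}: the access costs X, fetch(x) at most 7X - Φ_x,
-- and each of the at most r - 1 budget increments raises Φ by at most 7X. Let y ∈ R be OPT's
-- cheapest element. If p(y) ≤ p*(y) + κ then X ≤ 2^{p(y)} ≤ 2^κ ΔOPT. Otherwise y is in the
-- high regime: if y = x then Φ_x ≥ (7(r - 1) + 8)X pays for everything, and if y ≠ x the
-- increment of b(y) lowers Φ_y by γX, which does.

module Submission where

open import Defs
open import Algebra.Bundles using (CommutativeMonoid)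
open import Data.Bool using (true; false; if_then_else_)
open import Data.Empty using (⊥-elim)
open import Data.Fin.Properties using () renaming (_≟_ to _≟ᶠ_)
open import Data.Integer as ℤ using (ℤ; +_)
import Data.Integer.Properties as ℤₚ
open import Data.Integer.Tactic.RingSolver using (solve-∀)
open import Data.Nat.Tactic.RingSolver using () renaming (solve-∀ to ℕ-solve-∀)
open import Data.List using (List; []; _∷_; length; map; foldr; _++_; filter; allFin; lookup)
import Data.List.Properties as Listₚ
open import Data.List.Membership.Propositional using (_∈_; _∉_)
open import Data.List.Membership.Propositional.Properties using (∈-allFin; ∈-filter⁻; ∈-filter⁺; ∈-lookup)
open import Data.List.Relation.Binary.Subset.Propositional using (_⊆_)
open import Data.List.Relation.Unary.All as All using (All; []; _∷_)
open import Data.List.Relation.Unary.Any using (here; there)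
open import Data.List.Relation.Unary.AllPairs using ([]; _∷_)
open import Data.List.Relation.Unary.Unique.Propositional using (Unique)
open import Data.List.Relation.Unary.Unique.Propositional.Properties using (allFin⁺)
open import Data.Nat using (ℕ; zero; suc; _+_; _*_; _∸_; _^_; _≤_; _<_; z≤n; s≤s; _≤?_; _<?_; _≟_; _⊓_; NonZero; ⌈_/2⌉)
open import Data.Nat.Logarithm using (⌈log₂_⌉)
open import Data.Nat.Logarithm.Core using (⌈log2⌉)
open import Induction.WellFounded using (Acc; acc)
import Data.Nat.Properties as ℕₚ
open import Data.Product using (∃; _×_; _,_; proj₁; proj₂)
open import Data.Rational as ℚ using (ℚ; _/_; 0ℚ)
import Data.Rational.Properties as ℚₚ
import Data.Rational.Unnormalised as ℚᵘ
import Data.Rational.Unnormalised.Properties as ℚᵘₚ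
open import Data.Sum using (_⊎_; inj₁; inj₂; map₂)
open import Function using (_∘_; case_of_)
open import Relation.Binary.Definitions using (DecidableEquality)
open import Relation.Binary.PropositionalEquality as ≡ using (_≡_; _≢_; refl; cong; cong₂; subst)
open import Relation.Nullary using (Dec; yes; no; ¬_; isYes)
open import Relation.Nullary.Decidable using (toSum; isYes≗does; dec-true; dec-false)
open import Relation.Unary using (Decidable)

-- Sums over lists

module ListSum {c ℓ} (M : CommutativeMonoid c ℓ) where

  open CommutativeMonoid M renaming (refl to ≈-refl; sym to ≈-sym; trans to ≈-trans)
  open import Algebra.Properties.CommutativeSemigroup commutativeSemigroup using (interchange)
  open import Relation.Binary.Reasoning.Setoid setoid

  sum : ∀ {a} {A : Set a} → List A → (A → Carrier) → Carrier
  sum L f = foldr (λ u acc → f u ∙ acc) ε L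

  module _ {a} {A : Set a} where

    sum-cong : ∀ (L : List A) {f g} → (∀ {u} → u ∈ L → f u ≈ g u) → sum L f ≈ sum L g
    sum-cong []      eq = ≈-refl
    sum-cong (u ∷ L) eq = ∙-cong (eq (here refl)) (sum-cong L (eq ∘ there))

    sum-ε : ∀ (L : List A) {f} → (∀ {u} → u ∈ L → f u ≈ ε) → sum L f ≈ ε
    sum-ε L eq = ≈-trans (sum-cong L eq) (sum-const-ε L)
      where
      sum-const-ε : ∀ (L : List A) → sum L (λ _ → ε) ≈ ε
      sum-const-ε []      = ≈-refl
      sum-const-ε (u ∷ L) = ≈-trans (identityˡ _) (sum-const-ε L)

    sum-∙ : ∀ (L : List A) f g → sum L (λ u → f u ∙ g u) ≈ sum L f ∙ sum L g
    sum-∙ []      f g = ≈-sym (identityˡ ε)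
    sum-∙ (u ∷ L) f g = begin
      (f u ∙ g u) ∙ sum L (λ v → f v ∙ g v) ≈⟨ ∙-congˡ (sum-∙ L f g) ⟩
      (f u ∙ g u) ∙ (sum L f ∙ sum L g)     ≈⟨ interchange (f u) (g u) (sum L f) (sum L g) ⟩
      (f u ∙ sum L f) ∙ (g u ∙ sum L g)     ∎

  module _ {a} {A : Set a} (_≟_ : DecidableEquality A) where

    open import Data.List.Membership.DecPropositional _≟_ using (_∈?_)

    indicator : A → Carrier → A → Carrier
    indicator z x u = if isYes (u ≟ z) then x else ε

    indicator-self : ∀ z x → indicator z x z ≡ x
    indicator-self z x with z ≟ z
    ... | yes _  = refl
    ... | no z≢z = ⊥-elim (z≢z refl)

    indicator-other : ∀ {z u} x → u ≢ z → indicator z x u ≡ ε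
    indicator-other {z} {u} x u≢z with u ≟ z
    ... | yes u≡z = ⊥-elim (u≢z u≡z)
    ... | no _    = refl

    sum-indicator : ∀ {L : List A} {z} x → Unique L → z ∈ L → sum L (indicator z x) ≈ x
    sum-indicator {u ∷ L} x (u∉L ∷ _) (here refl) = begin
      indicator u x u ∙ sum L (indicator u x) ≈⟨ ∙-cong (reflexive (indicator-self u x)) (sum-ε L others) ⟩
      x ∙ ε                                   ≈⟨ identityʳ x ⟩
      x                                       ∎
      where
      others : ∀ {v} → v ∈ L → indicator u x v ≈ ε
      others v∈L = reflexive (indicator-other x (≡.≢-sym (All.lookup u∉L v∈L)))
    sum-indicator {u ∷ L} {z} x (u∉L ∷ uniq) (there z∈L) = begin
      indicator z x u ∙ sum L (indicator z x)
        ≈⟨ ∙-cong (reflexive (indicator-other x (All.lookup u∉L z∈L))) (sum-indicator x uniq z∈L) ⟩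
      ε ∙ x                                   ≈⟨ identityˡ x ⟩
      x                                       ∎

    outside : List A → (A → Carrier) → A → Carrier
    outside T f u = if isYes (u ∈? T) then ε else f u

    outside-∈ : ∀ {T u} f → u ∈ T → outside T f u ≡ ε
    outside-∈ {T} {u} f u∈T with u ∈? T
    ... | yes _   = refl
    ... | no u∉T  = ⊥-elim (u∉T u∈T)

    outside-∉ : ∀ {T u} f → u ∉ T → outside T f u ≡ f u
    outside-∉ {T} {u} f u∉T with u ∈? T
    ... | yes u∈T = ⊥-elim (u∉T u∈T)
    ... | no _    = refl

    sum-split : ∀ {L T : List A} f → Unique L → Unique T → T ⊆ L →
                sum L f ≈ sum T f ∙ sum L (outside T f)
    sum-split {L} {[]} f _ _ _ = ≈-sym (identityˡ _)
    sum-split {L} {t ∷ T} f uniqL (t∉T ∷ uniqT) T⊆L = begin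
      sum L f                                        ≈⟨ sum-split f uniqL uniqT (T⊆L ∘ there) ⟩
      sum T f ∙ sum L (outside T f)                  ≈⟨ ∙-congˡ (sum-cong L (λ _ → peel)) ⟩
      sum T f ∙ sum L (λ u → indicator t (f t) u ∙ outside (t ∷ T) f u)
                                                     ≈⟨ ∙-congˡ (sum-∙ L _ _) ⟩
      sum T f ∙ (sum L (indicator t (f t)) ∙ sum L (outside (t ∷ T) f))
                                                     ≈⟨ ∙-congˡ (∙-congʳ (sum-indicator (f t) uniqL (T⊆L (here refl)))) ⟩
      sum T f ∙ (f t ∙ sum L (outside (t ∷ T) f))    ≈⟨ ≈-sym (assoc _ _ _) ⟩
      (sum T f ∙ f t) ∙ sum L (outside (t ∷ T) f)    ≈⟨ ∙-congʳ (comm _ _) ⟩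
      (f t ∙ sum T f) ∙ sum L (outside (t ∷ T) f)    ∎
      where
      peel : ∀ {u} → outside T f u ≈ indicator t (f t) u ∙ outside (t ∷ T) f u
      peel {u} with toSum (u ≟ t)
      ... | inj₁ refl = begin
        outside T f u       ≡⟨ outside-∉ f (λ u∈T → All.lookup t∉T u∈T refl) ⟩
        f u                 ≈⟨ ≈-sym (identityʳ _) ⟩
        f u ∙ ε             ≡⟨ ≡.cong₂ _∙_ (≡.sym (indicator-self u (f u))) (≡.sym (outside-∈ f (here refl))) ⟩
        indicator u (f u) u ∙ outside (u ∷ T) f u ∎
      ... | inj₂ u≢t = begin
        outside T f u       ≈⟨ ≈-sym (identityˡ _) ⟩
        ε ∙ outside T f u   ≡⟨ ≡.cong₂ _∙_ (≡.sym (indicator-other (f t) u≢t)) (outside-drop u≢t) ⟩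
        indicator t (f t) u ∙ outside (t ∷ T) f u ∎
        where
        outside-drop : u ≢ t → outside T f u ≡ outside (t ∷ T) f u
        outside-drop u≢t with toSum (u ∈? T)
        ... | inj₁ u∈T = ≡.trans (outside-∈ f u∈T) (≡.sym (outside-∈ f (there u∈T)))
        ... | inj₂ u∉T = ≡.trans (outside-∉ f u∉T) (≡.sym (outside-∉ f λ { (here u≡t) → u≢t u≡t ; (there u∈T) → u∉T u∈T }))

    sum-vanishing : ∀ {L T : List A} {f} → Unique L → Unique T → T ⊆ L →
                    (∀ {u} → u ∉ T → f u ≈ ε) → sum L f ≈ sum T f
    sum-vanishing {L} {T} {f} uniqL uniqT T⊆L zero-off = begin
      sum L f                       ≈⟨ sum-split f uniqL uniqT T⊆L ⟩
      sum T f ∙ sum L (outside T f) ≈⟨ ∙-congˡ (sum-ε L (λ {u} _ → vanish u)) ⟩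
      sum T f ∙ ε                   ≈⟨ identityʳ _ ⟩
      sum T f                       ∎
      where
      vanish : ∀ u → outside T f u ≈ ε
      vanish u with toSum (u ∈? T)
      ... | inj₁ u∈T = reflexive (outside-∈ f u∈T)
      ... | inj₂ u∉T = ≈-trans (reflexive (outside-∉ f u∉T)) (zero-off u∉T)

    sum-agree : ∀ {L T : List A} {f g} → Unique L → Unique T → T ⊆ L →
                (∀ {u} → u ∉ T → f u ≈ g u) → sum T f ≈ sum T g → sum L f ≈ sum L g
    sum-agree {L} {T} {f} {g} uniqL uniqT T⊆L agree-off agree-on = begin
      sum L f                       ≈⟨ sum-split f uniqL uniqT T⊆L ⟩
      sum T f ∙ sum L (outside T f) ≈⟨ ∙-cong agree-on (sum-cong L (λ {u} _ → same u)) ⟩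
      sum T g ∙ sum L (outside T g) ≈⟨ ≈-sym (sum-split g uniqL uniqT T⊆L) ⟩
      sum L g                       ∎
      where
      same : ∀ u → outside T f u ≈ outside T g u
      same u with toSum (u ∈? T)
      ... | inj₁ u∈T = reflexive (≡.trans (outside-∈ f u∈T) (≡.sym (outside-∈ g u∈T)))
      ... | inj₂ u∉T = ≈-trans (reflexive (outside-∉ f u∉T)) (≈-trans (agree-off u∉T) (reflexive (≡.sym (outside-∉ g u∉T))))

module Σℕ = ListSum ℕₚ.+-0-commutativeMonoid
module Σℤ = ListSum ℤₚ.+-0-commutativeMonoid
open Σℕ using () renaming (sum to ∑ℕ)
open Σℤ using () renaming (sum to ∑ℤ)

isYes-true : ∀ {P : Set} (P? : Dec P) → P → isYes P? ≡ true
isYes-true P? p = ≡.trans (isYes≗does P?) (dec-true P? p)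

isYes-false : ∀ {P : Set} (P? : Dec P) → ¬ P → isYes P? ≡ false
isYes-false P? ¬p = ≡.trans (isYes≗does P?) (dec-false P? ¬p)

𝟙 : ∀ {P : Set} → Dec P → ℕ
𝟙 (yes _) = 1
𝟙 (no _)  = 0

module _ {A : Set} where

  length-filter≡∑𝟙 : ∀ {P : A → Set} (P? : Decidable P) (L : List A) →
                     length (filter P? L) ≡ ∑ℕ L (𝟙 ∘ P?)
  length-filter≡∑𝟙 P? []      = refl
  length-filter≡∑𝟙 P? (u ∷ L) with P? u
  ... | yes _ = cong suc (length-filter≡∑𝟙 P? L)
  ... | no _  = length-filter≡∑𝟙 P? L

  ∑ℕ-mono : ∀ (L : List A) {f g} → (∀ u → f u ≤ g u) → ∑ℕ L f ≤ ∑ℕ L g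
  ∑ℕ-mono []      f≤g = z≤n
  ∑ℕ-mono (u ∷ L) f≤g = ℕₚ.+-mono-≤ (f≤g u) (∑ℕ-mono L f≤g)

  ∑ℕ-*ˡ : ∀ (L : List A) c f → ∑ℕ L (λ u → c * f u) ≡ c * ∑ℕ L f
  ∑ℕ-*ˡ []      c f = ≡.sym (ℕₚ.*-zeroʳ c)
  ∑ℕ-*ˡ (u ∷ L) c f = ≡.trans (cong (_+_ (c * f u)) (∑ℕ-*ˡ L c f)) (≡.sym (ℕₚ.*-distribˡ-+ c (f u) (∑ℕ L f)))

  ∑ℕ-filter-≤ : ∀ {P : A → Set} (P? : Decidable P) (L : List A) {f g} →
                (∀ u → P u → f u ≤ g u) → ∑ℕ (filter P? L) f ≤ ∑ℕ L g
  ∑ℕ-filter-≤ P? []      f≤g = z≤n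
  ∑ℕ-filter-≤ P? (u ∷ L) {g = g} f≤g with P? u
  ... | yes Pu = ℕₚ.+-mono-≤ (f≤g u Pu) (∑ℕ-filter-≤ P? L f≤g)
  ... | no _   = ℕₚ.≤-trans (∑ℕ-filter-≤ P? L f≤g) (ℕₚ.m≤n+m _ (g u))

  ∑ℤ-mono-∈ : ∀ (L : List A) {f g} → (∀ {u} → u ∈ L → f u ℤ.≤ g u) → ∑ℤ L f ℤ.≤ ∑ℤ L g
  ∑ℤ-mono-∈ []      f≤g = ℤₚ.≤-refl
  ∑ℤ-mono-∈ (u ∷ L) f≤g = ℤₚ.+-mono-≤ (f≤g (here refl)) (∑ℤ-mono-∈ L (f≤g ∘ there))

  ∑ℤ-neg : ∀ (L : List A) f → ∑ℤ L (λ u → ℤ.- f u) ≡ ℤ.- ∑ℤ L f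
  ∑ℤ-neg []      f = refl
  ∑ℤ-neg (u ∷ L) f = ≡.trans (cong (ℤ._+_ (ℤ.- f u)) (∑ℤ-neg L f)) (≡.sym (ℤₚ.neg-distrib-+ (f u) (∑ℤ L f)))

  ∑ℤ-- : ∀ (L : List A) f g → ∑ℤ L (λ u → f u ℤ.- g u) ≡ ∑ℤ L f ℤ.- ∑ℤ L g
  ∑ℤ-- L f g = ≡.trans (Σℤ.sum-∙ L f (λ u → ℤ.- g u)) (cong (ℤ._+_ (∑ℤ L f)) (∑ℤ-neg L g))

  ∑ℤ-const : ∀ (L : List A) k → ∑ℤ L (λ _ → k) ≡ + length L ℤ.* k
  ∑ℤ-const []      k = ≡.sym (ℤₚ.*-zeroˡ k)
  ∑ℤ-const (u ∷ L) k = ≡.trans (cong (ℤ._+_ k) (∑ℤ-const L k)) (≡.sym (ℤₚ.suc-* (+ length L) k))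

  ∑ℤ-pos : ∀ (L : List A) f → ∑ℤ L (λ u → + f u) ≡ + ∑ℕ L f
  ∑ℤ-pos []      f = refl
  ∑ℤ-pos (u ∷ L) f = cong (ℤ._+_ (+ f u)) (∑ℤ-pos L f)

m+n≤o⇒+m≤+o-+n : ∀ {a b c} → c + b ≤ a → + c ℤ.≤ + a ℤ.- + b
m+n≤o⇒+m≤+o-+n {a} {b} {c} c+b≤a = ℤₚ.≤-trans (ℤ.+≤+ (ℕₚ.m+n≤o⇒m≤o∸n c c+b≤a))
  (ℤₚ.≤-reflexive (≡.sym (≡.trans (ℤₚ.m-n≡m⊖n a b) (ℤₚ.⊖-≥ (ℕₚ.≤-trans (ℕₚ.m≤n+m b c) c+b≤a)))))

scaled-increment : ∀ k B a → + (k * (B + a)) ℤ.- + (k * B) ≡ + (k * a)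
scaled-increment k B a = ≡.trans (cong (λ n → + n ℤ.- + (k * B)) (ℕₚ.*-distribˡ-+ k B a))
                                 (cancel (+ (k * B)) (+ (k * a)))
  where
  cancel : ∀ b c → b ℤ.+ c ℤ.- b ≡ c
  cancel = solve-∀

scaled-decrement : ∀ c k B a → (c ℤ.- + (k * (B + a))) ℤ.- (c ℤ.- + (k * B)) ≡ ℤ.- + (k * a)
scaled-decrement c k B a = ≡.trans (cancel c (+ (k * (B + a))) (+ (k * B))) (cong ℤ.-_ (scaled-increment k B a))
  where
  cancel : ∀ c x y → (c ℤ.- x) ℤ.- (c ℤ.- y) ≡ ℤ.- (x ℤ.- y)
  cancel = solve-∀

∑< : ℕ → (ℕ → ℕ) → ℕ
∑< zero    g = 0
∑< (suc k) g = g k + ∑< k g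

∑<-rotate : ∀ k g → g 0 + ∑< k (g ∘ suc) ≡ g k + ∑< k g
∑<-rotate zero    g = refl
∑<-rotate (suc k) g = begin
  g 0 + (g (suc k) + ∑< k (g ∘ suc)) ≡⟨ swap (g 0) (g (suc k)) _ ⟩
  g (suc k) + (g 0 + ∑< k (g ∘ suc)) ≡⟨ cong (_+_ (g (suc k))) (∑<-rotate k g) ⟩
  g (suc k) + (g k + ∑< k g)         ∎
  where
  open ≡.≡-Reasoning
  swap : ∀ a b c → a + (b + c) ≡ b + (a + c)
  swap a b c = ≡.trans (≡.sym (ℕₚ.+-assoc a b c)) (≡.trans (cong (_+ c) (ℕₚ.+-comm a b)) (ℕₚ.+-assoc b a c))

n≤2^⌈log₂n⌉ : ∀ n → n ≤ 2 ^ ⌈log₂ n ⌉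
n≤2^⌈log₂n⌉ n = go n _
  where
  go : ∀ n (acc : Acc _<_ n) → n ≤ 2 ^ ⌈log2⌉ n acc
  go zero             _        = z≤n
  go (suc zero)       _        = s≤s z≤n
  go (suc (suc n)) (acc rs) = ℕₚ.≤-trans 2+n≤2[1+⌈n/2⌉] (ℕₚ.*-monoʳ-≤ 2 (go (suc ⌈ n /2⌉) _))
    where
    n≤⌈n/2⌉+⌈n/2⌉ : n ≤ ⌈ n /2⌉ + ⌈ n /2⌉
    n≤⌈n/2⌉+⌈n/2⌉ = subst (_≤ ⌈ n /2⌉ + ⌈ n /2⌉) (ℕₚ.⌊n/2⌋+⌈n/2⌉≡n n) (ℕₚ.+-monoˡ-≤ ⌈ n /2⌉ (ℕₚ.⌊n/2⌋≤⌈n/2⌉ n))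
    2+n≤2[1+⌈n/2⌉] : suc (suc n) ≤ 2 * suc ⌈ n /2⌉
    2+n≤2[1+⌈n/2⌉] = ℕₚ.≤-trans (s≤s (s≤s n≤⌈n/2⌉+⌈n/2⌉)) (ℕₚ.≤-reflexive (expand ⌈ n /2⌉))
      where
      expand : ∀ c → 2 + (c + c) ≡ 2 * suc c
      expand = ℕ-solve-∀

-- Expectation bounds for finite distributions

fromℤ : ℤ → ℚ
fromℤ z = z / 1

toℚᵘ-fromℤ : ∀ z → ℚ.toℚᵘ (fromℤ z) ℚᵘ.≃ ℚᵘ.mkℚᵘ z 0
toℚᵘ-fromℤ z = ℚₚ.toℚᵘ-fromℚᵘ (ℚᵘ.mkℚᵘ z 0)

fromℤ-+ : ∀ a b → fromℤ (a ℤ.+ b) ≡ fromℤ a ℚ.+ fromℤ b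
fromℤ-+ a b = ℚₚ.toℚᵘ-injective
  (ℚᵘₚ.≃-trans (toℚᵘ-fromℤ (a ℤ.+ b))
  (ℚᵘₚ.≃-trans (ℚᵘ.*≡* (denominators-one a b))
  (ℚᵘₚ.≃-sym (ℚᵘₚ.≃-trans (ℚₚ.toℚᵘ-homo-+ (fromℤ a) (fromℤ b))
                          (ℚᵘₚ.+-cong (toℚᵘ-fromℤ a) (toℚᵘ-fromℤ b))))))
  where
  denominators-one : ∀ a b → (a ℤ.+ b) ℤ.* + 1 ≡ (a ℤ.* + 1 ℤ.+ b ℤ.* + 1) ℤ.* + 1
  denominators-one = solve-∀

fromℤ-mono-≤ : ∀ {a b} → a ℤ.≤ b → fromℤ a ℚ.≤ fromℤ b
fromℤ-mono-≤ {a} {b} a≤b = ℚₚ.toℚᵘ-cancel-≤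
  (ℚᵘₚ.≤-respˡ-≃ (ℚᵘₚ.≃-sym (toℚᵘ-fromℤ a)) (ℚᵘₚ.≤-respʳ-≃ (ℚᵘₚ.≃-sym (toℚᵘ-fromℤ b))
    (ℚᵘ.*≤* (ℤₚ.*-monoʳ-≤-nonNeg (+ 1) a≤b))))

average-≤ : ∀ m s b → s ℤ.≤ + suc m ℤ.* b → (+ 1 / suc m) ℚ.* fromℤ s ℚ.≤ fromℤ b
average-≤ m s b s≤nb = ℚₚ.toℚᵘ-cancel-≤
  (ℚᵘₚ.≤-respˡ-≃ (ℚᵘₚ.≃-sym (ℚₚ.toℚᵘ-homo-* (+ 1 / suc m) (fromℤ s)))
  (ℚᵘₚ.≤-respˡ-≃ (ℚᵘₚ.≃-sym (ℚᵘₚ.*-cong (ℚₚ.toℚᵘ-fromℚᵘ (ℚᵘ.mkℚᵘ (+ 1) m)) (toℚᵘ-fromℤ s)))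
  (ℚᵘₚ.≤-respʳ-≃ (ℚᵘₚ.≃-sym (toℚᵘ-fromℤ b))
  (ℚᵘ.*≤* (ℤₚ.≤-trans (ℤₚ.≤-reflexive (one-times s))
          (ℤₚ.≤-trans s≤nb (ℤₚ.≤-reflexive (≡.trans (ℤₚ.*-comm (+ suc m) b)
                                                    (cong (λ n → b ℤ.* + suc n) (≡.sym (ℕₚ.*-identityʳ m)))))))))))
  where
  one-times : ∀ s → (+ 1 ℤ.* s) ℤ.* + 1 ≡ s
  one-times = solve-∀

E : ∀ {A : Set} → Dist A → (A → ℚ) → ℚ
E d h = foldr (λ wa acc → proj₁ wa ℚ.* h (proj₂ wa) ℚ.+ acc) 0ℚ d

module _ {A : Set} where

  𝔼≡E : ∀ (d : Dist A) f → 𝔼 d f ≡ E d (fromℤ ∘ f)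
  𝔼≡E []            f = refl
  𝔼≡E ((w , a) ∷ d) f = cong (w ℚ.* fromℤ (f a) ℚ.+_) (𝔼≡E d f)

  E-cong : ∀ (d : Dist A) {h h'} → (∀ a → h a ≡ h' a) → E d h ≡ E d h'
  E-cong []            eq = refl
  E-cong ((w , a) ∷ d) eq = cong₂ (λ x y → w ℚ.* x ℚ.+ y) (eq a) (E-cong d eq)

  E-++ : ∀ (d d' : Dist A) h → E (d ++ d') h ≡ E d h ℚ.+ E d' h
  E-++ []            d' h = ≡.sym (ℚₚ.+-identityˡ _)
  E-++ ((w , a) ∷ d) d' h = ≡.trans (cong (w ℚ.* h a ℚ.+_) (E-++ d d' h)) (≡.sym (ℚₚ.+-assoc (w ℚ.* h a) (E d h) (E d' h)))

  E-scale : ∀ w (d : Dist A) h → E (map (λ { (v , b) → (w ℚ.* v , b) }) d) h ≡ w ℚ.* E d h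
  E-scale w []            h = ≡.sym (ℚₚ.*-zeroʳ w)
  E-scale w ((v , b) ∷ d) h =
    ≡.trans (cong₂ ℚ._+_ (ℚₚ.*-assoc w v (h b)) (E-scale w d h)) (≡.sym (ℚₚ.*-distribˡ-+ w (v ℚ.* h b) (E d h)))

  E-return : ∀ (a : A) h → E (return a) h ≡ h a
  E-return a h = ≡.trans (ℚₚ.+-identityʳ _) (ℚₚ.*-identityˡ (h a))

  E-uniform : ∀ x (L : List A) f →
              E (uniform (x ∷ L)) (fromℤ ∘ f) ≡ (+ 1 / suc (length L)) ℚ.* fromℤ (∑ℤ (x ∷ L) f)
  E-uniform x L f = go (x ∷ L)
    where
    q = + 1 / suc (length L)
    go : ∀ M → E (map (λ a → (q , a)) M) (fromℤ ∘ f) ≡ q ℚ.* fromℤ (∑ℤ M f)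
    go []      = ≡.sym (ℚₚ.*-zeroʳ q)
    go (a ∷ M) = begin
      q ℚ.* fromℤ (f a) ℚ.+ E (map (λ a → (q , a)) M) (fromℤ ∘ f) ≡⟨ cong (q ℚ.* fromℤ (f a) ℚ.+_) (go M) ⟩
      q ℚ.* fromℤ (f a) ℚ.+ q ℚ.* fromℤ (∑ℤ M f)                   ≡⟨ ≡.sym (ℚₚ.*-distribˡ-+ q _ _) ⟩
      q ℚ.* (fromℤ (f a) ℚ.+ fromℤ (∑ℤ M f))                       ≡⟨ cong (q ℚ.*_) (≡.sym (fromℤ-+ (f a) _)) ⟩
      q ℚ.* fromℤ (∑ℤ (a ∷ M) f)                                   ∎
      where open ≡.≡-Reasoning

E-bind : ∀ {A B : Set} (d : Dist A) (k : A → Dist B) h → E (d >>= k) h ≡ E d (λ a → E (k a) h)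
E-bind []            k h = refl
E-bind ((w , a) ∷ d) k h =
  ≡.trans (E-++ (map (λ { (v , b) → (w ℚ.* v , b) }) (k a)) (d >>= k) h)
          (cong₂ ℚ._+_ (E-scale w (k a) h) (E-bind d k h))

Always : ∀ {A : Set} → (A → Set) → Dist A → Set
Always P d = All (λ wa → ℚ.NonNegative (proj₁ wa) × P (proj₂ wa)) d

module _ {A : Set} {P : A → Set} where

  Always-return : ∀ {a} → P a → Always P (return a)
  Always-return Pa = (_ , Pa) ∷ []

  Always-++ : ∀ {d d' : Dist A} → Always P d → Always P d' → Always P (d ++ d')
  Always-++ []        Pd' = Pd'
  Always-++ (x ∷ Pd) Pd' = x ∷ Always-++ Pd Pd'

  Always-scale : ∀ w .{{_ : ℚ.NonNegative w}} {d : Dist A} → Always P d →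
                 Always P (map (λ { (v , b) → (w ℚ.* v , b) }) d)
  Always-scale w []                = []
  Always-scale w ((v≥0 , Pb) ∷ Pd) = (ℚₚ.nonNeg*nonNeg⇒nonNeg w _ {{v≥0}} , Pb) ∷ Always-scale w Pd

  Always-⇒ : ∀ {d : Dist A} {a} → Always P d → a ∈supp d → P a
  Always-⇒ Pd (_ , wa∈d) = proj₂ (All.lookup Pd wa∈d)

  E-mono : ∀ {d : Dist A} {h h'} → Always P d → (∀ a → P a → h a ℚ.≤ h' a) → E d h ℚ.≤ E d h'
  E-mono {[]}          []                h≤h' = ℚₚ.≤-refl
  E-mono {(w , a) ∷ d} ((w≥0 , Pa) ∷ Pd) h≤h' =
    ℚₚ.+-mono-≤ (ℚₚ.*-monoˡ-≤-nonNeg w {{w≥0}} (h≤h' a Pa)) (E-mono Pd h≤h')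

Always-bind : ∀ {A B : Set} {P : A → Set} {Q : B → Set} {d : Dist A} {k : A → Dist B} →
              Always P d → (∀ a → P a → Always Q (k a)) → Always Q (d >>= k)
Always-bind {d = []}    []                 Pk = []
Always-bind {d = (w , a) ∷ d} ((w≥0 , Pa) ∷ Pd) Pk =
  Always-++ (Always-scale w {{w≥0}} (Pk a Pa)) (Always-bind Pd Pk)

Always-uniform : ∀ {A : Set} (L : List A) → Always (_∈ L) (uniform L)
Always-uniform []      = []
Always-uniform (x ∷ L) = go (x ∷ L) (λ m → m)
  where
  go : ∀ M → (∀ {u} → u ∈ M → u ∈ x ∷ L) → Always (_∈ x ∷ L) (map (λ a → (+ 1 / suc (length L) , a)) M)
  go []      _   = []
  go (a ∷ M) M⊆L = (ℚₚ.normalize-nonNeg 1 (suc (length L)) , M⊆L (here refl)) ∷ go M (M⊆L ∘ there)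

-- Expectation bounds are stated uniformly in an additive offset K: E is additive
-- only up to the total mass of the distribution, which is never tracked.
record 𝔼≤ {A : Set} (d : Dist A) (f : A → ℤ) (c : ℤ) : Set where
  constructor bounded
  field offset : ∀ K → E d (λ a → fromℤ (K ℤ.+ f a)) ℚ.≤ fromℤ (K ℤ.+ c)

open 𝔼≤

module _ {A : Set} where

  𝔼≤-return : ∀ {a : A} {f c} → f a ℤ.≤ c → 𝔼≤ (return a) f c
  𝔼≤-return {a} {f} fa≤c = bounded λ K →
    ℚₚ.≤-trans (ℚₚ.≤-reflexive (E-return a (λ b → fromℤ (K ℤ.+ f b)))) (fromℤ-mono-≤ (ℤₚ.+-monoʳ-≤ K fa≤c))

  𝔼≤-weaken : ∀ {d : Dist A} {f c c'} → c ℤ.≤ c' → 𝔼≤ d f c → 𝔼≤ d f c'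
  𝔼≤-weaken c≤c' bound = bounded λ K → ℚₚ.≤-trans (offset bound K) (fromℤ-mono-≤ (ℤₚ.+-monoʳ-≤ K c≤c'))

  𝔼≤-cong : ∀ {d : Dist A} {f f' c c'} → (∀ a → f a ≡ f' a) → c ≡ c' → 𝔼≤ d f c → 𝔼≤ d f' c'
  𝔼≤-cong {d} f≗f' refl bound = bounded λ K →
    ℚₚ.≤-trans (ℚₚ.≤-reflexive (E-cong d (λ a → cong (fromℤ ∘ ℤ._+_ K) (≡.sym (f≗f' a))))) (offset bound K)

  𝔼≤-shiftˡ : ∀ {d : Dist A} {f c} e → 𝔼≤ d f c → 𝔼≤ d (λ a → e ℤ.+ f a) (e ℤ.+ c)
  𝔼≤-shiftˡ {d} {f} {c} e bound = bounded λ K → begin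
    E d (λ a → fromℤ (K ℤ.+ (e ℤ.+ f a))) ≡⟨ E-cong d (λ a → cong fromℤ (≡.sym (ℤₚ.+-assoc K e (f a)))) ⟩
    E d (λ a → fromℤ (K ℤ.+ e ℤ.+ f a))   ≤⟨ offset bound (K ℤ.+ e) ⟩
    fromℤ (K ℤ.+ e ℤ.+ c)                 ≡⟨ cong fromℤ (ℤₚ.+-assoc K e c) ⟩
    fromℤ (K ℤ.+ (e ℤ.+ c))               ∎
    where open ℚₚ.≤-Reasoning

  𝔼≤-shiftʳ : ∀ {d : Dist A} {f c} e → 𝔼≤ d f c → 𝔼≤ d (λ a → f a ℤ.+ e) (c ℤ.+ e)
  𝔼≤-shiftʳ {f = f} {c} e bound = 𝔼≤-cong (λ a → ℤₚ.+-comm e (f a)) (ℤₚ.+-comm e c) (𝔼≤-shiftˡ e bound)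

  𝔼≤-uniform : ∀ {L : List A} {f c} → L ≢ [] → ∑ℤ L f ℤ.≤ + length L ℤ.* c → 𝔼≤ (uniform L) f c
  𝔼≤-uniform {[]}    L≢[] _ = ⊥-elim (L≢[] refl)
  𝔼≤-uniform {x ∷ L} {f} {c} _ Σf≤nc = bounded λ K → begin
    E (uniform (x ∷ L)) (λ a → fromℤ (K ℤ.+ f a))       ≡⟨ E-uniform x L (λ a → K ℤ.+ f a) ⟩
    (+ 1 / n) ℚ.* fromℤ (∑ℤ (x ∷ L) (λ a → K ℤ.+ f a)) ≤⟨ average-≤ (length L) _ _ (total K) ⟩
    fromℤ (K ℤ.+ c)                                     ∎
    where
    open ℚₚ.≤-Reasoning
    n = suc (length L)
    total : ∀ K → ∑ℤ (x ∷ L) (λ a → K ℤ.+ f a) ℤ.≤ + n ℤ.* (K ℤ.+ c)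
    total K = ℤₚ.≤-trans (ℤₚ.≤-reflexive (≡.trans (Σℤ.sum-∙ (x ∷ L) (λ _ → K) f)
                                                   (cong (ℤ._+ ∑ℤ (x ∷ L) f) (∑ℤ-const (x ∷ L) K))))
              (ℤₚ.≤-trans (ℤₚ.+-monoʳ-≤ (+ n ℤ.* K) Σf≤nc)
                          (ℤₚ.≤-reflexive (≡.sym (ℤₚ.*-distribˡ-+ (+ n) K c))))

  𝔼≤-map : ∀ {B : Set} {d : Dist A} {t : A → B} {f c} → 𝔼≤ d (f ∘ t) c → 𝔼≤ (d >>= (return ∘ t)) f c
  𝔼≤-map {d = d} {t} {f} bound = bounded λ K → ℚₚ.≤-trans
    (ℚₚ.≤-reflexive (≡.trans (E-bind d (return ∘ t) _) (E-cong d (λ a → E-return (t a) (λ b → fromℤ (K ℤ.+ f b))))))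
    (offset bound K)

  𝔼≤⇒𝔼 : ∀ {d : Dist A} {f c} → 𝔼≤ d f c → 𝔼 d f ℚ.≤ fromℤ c
  𝔼≤⇒𝔼 {d} {f} {c} bound = ℚₚ.≤-trans
    (ℚₚ.≤-reflexive (≡.trans (𝔼≡E d f) (E-cong d (λ a → cong fromℤ (≡.sym (ℤₚ.+-identityˡ (f a)))))))
    (ℚₚ.≤-trans (offset bound (+ 0)) (ℚₚ.≤-reflexive (cong fromℤ (ℤₚ.+-identityˡ c))))

𝔼≤-bind : ∀ {A B : Set} {P : A → Set} {d : Dist A} {k : A → Dist B} {f g c} →
          Always P d → (∀ a → P a → 𝔼≤ (k a) f (g a)) → 𝔼≤ d g c → 𝔼≤ (d >>= k) f c
𝔼≤-bind {d = d} {k} Pd inner outer = bounded λ K →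
  ℚₚ.≤-trans (ℚₚ.≤-reflexive (E-bind d k _)) (ℚₚ.≤-trans (E-mono Pd (λ a Pa → offset (inner a Pa) K)) (offset outer K))

module Analysis (w : ℕ) where

  open LMA w
  open import Data.List.Membership.DecPropositional (_≟ᶠ_ {2 ^ w ∸ 1}) using (_∈?_)

  -- Fetching preserves validity

  allU : List U
  allU = allFin _

  allU-unique : Unique allU
  allU-unique = allFin⁺ _

  ⊆allU : ∀ {T : List U} → T ⊆ allU
  ⊆allU {x = u} _ = ∈-allFin u

  update-self : ∀ {A : Set} (f : U → A) z a → update f z a z ≡ a
  update-self f z a rewrite isYes-true (z ≟ᶠ z) refl = refl

  update-other : ∀ {A : Set} (f : U → A) {z u} a → u ≢ z → update f z a u ≡ f u
  update-other f {z} {u} a u≢z rewrite isYes-false (u ≟ᶠ z) u≢z = refl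

  movedPart-fetched : ∀ p z as → movedPart p z as z ≡ 0
  movedPart-fetched p z as rewrite isYes-true (z ≟ᶠ z) refl = refl

  movedPart-chosen : ∀ p {z as u} → u ≢ z → u ∈ as → movedPart p z as u ≡ suc (p u)
  movedPart-chosen p {z} {as} {u} u≢z u∈as rewrite isYes-false (u ≟ᶠ z) u≢z | isYes-true (u ∈? as) u∈as = refl

  movedPart-other : ∀ p {z as u} → u ≢ z → u ∉ as → movedPart p z as u ≡ p u
  movedPart-other p {z} {as} {u} u≢z u∉as rewrite isYes-false (u ≟ᶠ z) u≢z | isYes-false (u ∈? as) u∉as = refl

  addBudgets-requested : ∀ {R x} a b {u} → u ∈ R → u ≢ x → addBudgets R x a b u ≡ b u + a
  addBudgets-requested {R} {x} a b {u} u∈R u≢x rewrite isYes-true (u ∈? R) u∈R | isYes-false (u ≟ᶠ x) u≢x = refl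

  addBudgets-unrequested : ∀ {R x} a b {u} → u ∉ R → addBudgets R x a b u ≡ b u
  addBudgets-unrequested {R} {x} a b {u} u∉R rewrite isYes-false (u ∈? R) u∉R = refl

  addBudgets-chosen : ∀ R x a b → addBudgets R x a b x ≡ b x
  addBudgets-chosen R x a b with isYes (x ∈? R)
  ... | false = refl
  ... | true rewrite isYes-true (x ≟ᶠ x) refl = refl

  data Transversal (p : Partitioning) : ℕ → List U → Set where
    []  : Transversal p 0 []
    _∷_ : ∀ {k a as} → p a ≡ k → Transversal p k as → Transversal p (suc k) (a ∷ as)

  Transversal-< : ∀ {p k as u} → Transversal p k as → u ∈ as → p u < k
  Transversal-< (refl ∷ _)  (here refl)  = ℕₚ.≤-refl
  Transversal-< (_ ∷ tr)    (there u∈as) = ℕₚ.m≤n⇒m≤1+n (Transversal-< tr u∈as)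

  Transversal-unique : ∀ {p k as} → Transversal p k as → Unique as
  Transversal-unique []                    = []
  Transversal-unique {p} (pa≡k ∷ tr) =
    All.tabulate (λ u∈as a≡u → ℕₚ.<-irrefl (≡.trans (cong p (≡.sym a≡u)) pa≡k) (Transversal-< tr u∈as))
    ∷ Transversal-unique tr

  Transversal-∑ : ∀ {p k as} (g : ℕ → ℕ) → Transversal p k as → ∑ℕ as (g ∘ p) ≡ ∑< k g
  Transversal-∑ g []            = refl
  Transversal-∑ g (refl ∷ tr)   = cong (_+_ _) (Transversal-∑ g tr)

  Transversal-≢ : ∀ {p z as a} → Transversal p (p z) as → a ∈ as → a ≢ z
  Transversal-≢ tr a∈as refl = ℕₚ.<-irrefl refl (Transversal-< tr a∈as)

  Transversal-unique-∷ : ∀ {p z as} → Transversal p (p z) as → Unique (z ∷ as)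
  Transversal-unique-∷ tr = All.tabulate (≡.≢-sym ∘ Transversal-≢ tr) ∷ Transversal-unique tr

  choices-Transversal : ∀ p k → Always (Transversal p k) (choices p k)
  choices-Transversal p zero    = Always-return []
  choices-Transversal p (suc k) =
    Always-bind (choices-Transversal p k) λ as tr →
    Always-bind (Always-uniform (chunk p k)) λ a a∈S →
    Always-return (proj₂ (∈-filter⁻ (λ u → p u ≟ k) {xs = allU} a∈S) ∷ tr)

  count : Partitioning → ℕ → ℕ
  count p i = ∑ℕ allU (λ u → 𝟙 (p u ≟ i))

  length-chunk : ∀ p i → length (chunk p i) ≡ count p i
  length-chunk p i = length-filter≡∑𝟙 (λ u → p u ≟ i) allU

  count-movedPart : ∀ {p z as} i → Transversal p (p z) as → count (movedPart p z as) i ≡ count p i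
  count-movedPart {p} {z} {as} i tr =
    Σℕ.sum-agree _≟ᶠ_ allU-unique (Transversal-unique-∷ tr) ⊆allU unmoved moved
    where
    ind : ℕ → ℕ
    ind j = 𝟙 (j ≟ i)
    unmoved : ∀ {u} → u ∉ z ∷ as → ind (movedPart p z as u) ≡ ind (p u)
    unmoved u∉ = cong ind (movedPart-other p (u∉ ∘ here) (u∉ ∘ there))
    -- On z ∷ as the fetch rotates the chunk indices ℓ, ℓ-1, …, 0 into 0, ℓ, …, 1.
    moved : ∑ℕ (z ∷ as) (ind ∘ movedPart p z as) ≡ ∑ℕ (z ∷ as) (ind ∘ p)
    moved = begin
      ind (movedPart p z as z) + ∑ℕ as (ind ∘ movedPart p z as)
        ≡⟨ cong₂ _+_ (cong ind (movedPart-fetched p z as))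
                     (Σℕ.sum-cong as (λ a∈as → cong ind (movedPart-chosen p (Transversal-≢ tr a∈as) a∈as))) ⟩
      ind 0 + ∑ℕ as (ind ∘ suc ∘ p)  ≡⟨ cong (_+_ (ind 0)) (Transversal-∑ (ind ∘ suc) tr) ⟩
      ind 0 + ∑< (p z) (ind ∘ suc)   ≡⟨ ∑<-rotate (p z) ind ⟩
      ind (p z) + ∑< (p z) ind       ≡⟨ cong (_+_ (ind (p z))) (≡.sym (Transversal-∑ ind tr)) ⟩
      ind (p z) + ∑ℕ as (ind ∘ p)    ∎
      where open ≡.≡-Reasoning

  Valid-movedPart : ∀ {p z as} → Valid p → Transversal p (p z) as → Valid (movedPart p z as)
  Valid-movedPart {p} {z} {as} (p<w , |S|≡2^) tr = <w , λ i i<w → begin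
    length (chunk (movedPart p z as) i) ≡⟨ length-chunk _ i ⟩
    count (movedPart p z as) i          ≡⟨ count-movedPart i tr ⟩
    count p i                           ≡⟨ ≡.sym (length-chunk p i) ⟩
    length (chunk p i)                  ≡⟨ |S|≡2^ i i<w ⟩
    2 ^ i                               ∎
    where
    open ≡.≡-Reasoning
    <w : ∀ u → movedPart p z as u < w
    <w u with toSum (u ≟ᶠ z) | toSum (u ∈? as)
    ... | inj₁ refl | _       rewrite movedPart-fetched p u as = ℕₚ.≤-trans (s≤s z≤n) (p<w u)
    ... | inj₂ u≢z | inj₁ u∈as rewrite movedPart-chosen p u≢z u∈as = ℕₚ.≤-trans (s≤s (Transversal-< tr u∈as)) (p<w z)
    ... | inj₂ u≢z | inj₂ u∉as rewrite movedPart-other p u≢z u∉as = p<w u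

  -- The potential of a single element

  β-suc : ∀ r → β (suc r) ≡ 10 + 21 * r
  β-suc r = ≡.trans (cong (_∸ 11) (expand r)) (ℕₚ.m+n∸m≡n 11 (10 + 21 * r))
    where
    expand : ∀ r → 21 * suc r ≡ 11 + (10 + 21 * r)
    expand = ℕ-solve-∀

  γ-suc : ∀ r → γ (suc r) ≡ 1 + 7 * r
  γ-suc r = ≡.trans (cong (_∸ 6) (expand r)) (ℕₚ.m+n∸m≡n 6 (1 + 7 * r))
    where
    expand : ∀ r → 7 * suc r ≡ 6 + (1 + 7 * r)
    expand = ℕ-solve-∀

  -- The three bounds below only use β r ≥ α + 2 γ r = 9 + 14 (r - 1).
  9+14r≤β : ∀ r → 9 + 14 * r ≤ β (suc r)
  9+14r≤β r = ℕₚ.≤-trans (ℕₚ.+-mono-≤ (ℕₚ.n≤1+n 9) (ℕₚ.*-monoˡ-≤ r (ℕₚ.m≤m+n 14 7)))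
                         (ℕₚ.≤-reflexive (≡.sym (β-suc r)))

  βγ-violator : ∀ r .{{_ : NonZero r}} {X B} → B ≤ 2 * X → α * X + γ r * B ≤ β r * X
  βγ-violator (suc r) {X} {B} B≤2X = begin
    α * X + γ (suc r) * B       ≤⟨ ℕₚ.+-monoʳ-≤ (α * X) (ℕₚ.*-monoʳ-≤ (γ (suc r)) B≤2X) ⟩
    α * X + γ (suc r) * (2 * X) ≡⟨ cong (λ g → α * X + g * (2 * X)) (γ-suc r) ⟩
    7 * X + (1 + 7 * r) * (2 * X) ≡⟨ expand r X ⟩
    (9 + 14 * r) * X            ≤⟨ ℕₚ.*-monoˡ-≤ X (9+14r≤β r) ⟩
    β (suc r) * X               ∎
    where
    open ℕₚ.≤-Reasoning
    expand : ∀ r X → 7 * X + (1 + 7 * r) * (2 * X) ≡ (9 + 14 * r) * X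
    expand = ℕ-solve-∀

  βγ-nonneg : ∀ r .{{_ : NonZero r}} {X B} → B ≤ X → γ r * B ≤ β r * X
  βγ-nonneg (suc r) {X} {B} B≤X = begin
    γ (suc r) * B     ≤⟨ ℕₚ.*-monoʳ-≤ (γ (suc r)) B≤X ⟩
    γ (suc r) * X     ≡⟨ cong (_* X) (γ-suc r) ⟩
    (1 + 7 * r) * X   ≤⟨ ℕₚ.*-monoˡ-≤ X (ℕₚ.+-mono-≤ (ℕₚ.m≤m+n 1 8) (ℕₚ.*-monoˡ-≤ r (ℕₚ.m≤m+n 7 7))) ⟩
    (9 + 14 * r) * X  ≤⟨ ℕₚ.*-monoˡ-≤ X (9+14r≤β r) ⟩
    β (suc r) * X     ∎
    where open ℕₚ.≤-Reasoning

  βγ-high : ∀ r .{{_ : NonZero r}} {X B} → B ≤ X → (α * (r ∸ 1) + 8) * X + γ r * B ≤ β r * X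
  βγ-high (suc r) {X} {B} B≤X = begin
    (α * r + 8) * X + γ (suc r) * B ≤⟨ ℕₚ.+-monoʳ-≤ ((α * r + 8) * X) (ℕₚ.*-monoʳ-≤ (γ (suc r)) B≤X) ⟩
    (α * r + 8) * X + γ (suc r) * X ≡⟨ cong (λ g → (α * r + 8) * X + g * X) (γ-suc r) ⟩
    (7 * r + 8) * X + (1 + 7 * r) * X ≡⟨ expand r X ⟩
    (9 + 14 * r) * X                ≤⟨ ℕₚ.*-monoˡ-≤ X (9+14r≤β r) ⟩
    β (suc r) * X                   ∎
    where
    open ℕₚ.≤-Reasoning
    expand : ∀ r X → (7 * r + 8) * X + (1 + 7 * r) * X ≡ (9 + 14 * r) * X
    expand = ℕ-solve-∀

  φ : (r q P B : ℕ) → ℤ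
  φ r q P B with P ≤? q + κ r
  ... | yes _ = + (α * B)
  ... | no _  = + (β r * 2 ^ P) ℤ.- + (γ r * B)

  Φᵤ≡φ : ∀ r p* p b u → Φᵤ r p* (p , b) u ≡ φ r (p* u) (p u) (b u)
  Φᵤ≡φ r p* p b u with p u ≤? p* u + κ r
  ... | yes _ = refl
  ... | no _  = refl

  ΔΦᵤ : ℕ → Partitioning → State → State → U → ℤ
  ΔΦᵤ r p* s s' u = Φᵤ r p* s' u ℤ.- Φᵤ r p* s u

  ΔΦ≡∑ΔΦᵤ : ∀ r p* s s' → Φ r p* s' ℤ.- Φ r p* s ≡ ∑ℤ allU (ΔΦᵤ r p* s s')
  ΔΦ≡∑ΔΦᵤ r p* s s' = ≡.sym (∑ℤ-- allU (Φᵤ r p* s') (Φᵤ r p* s))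

  ΔΦᵤ≡Δφ : ∀ r p* s s' u → ΔΦᵤ r p* s s' u ≡ φ r (p* u) (part s' u) (budget s' u) ℤ.- φ r (p* u) (part s u) (budget s u)
  ΔΦᵤ≡Δφ r p* s s' u = cong₂ ℤ._-_ (Φᵤ≡φ r p* (part s') (budget s') u) (Φᵤ≡φ r p* (part s) (budget s) u)

  ΔΦᵤ-unchanged : ∀ r p* s s' {u} → part s' u ≡ part s u → budget s' u ≡ budget s u → ΔΦᵤ r p* s s' u ≡ + 0
  ΔΦᵤ-unchanged r p* s s' {u} p'≡p b'≡b = ≡.trans (ΔΦᵤ≡Δφ r p* s s' u)
    (≡.trans (cong₂ (λ P B → φ r (p* u) P B ℤ.- φ r (p* u) (part s u) (budget s u)) p'≡p b'≡b)
             (ℤₚ.+-inverseʳ (φ r (p* u) (part s u) (budget s u))))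

  promotionBound : (r q P : ℕ) → ℕ
  promotionBound r q P = β r * 2 ^ suc P * 𝟙 (q + κ r ≤? P)

  φ-fetched : ∀ r q → φ r q 0 0 ≡ + 0
  φ-fetched r q with 0 ≤? q + κ r
  ... | yes _  = refl
  ... | no 0≰  = ⊥-elim (0≰ z≤n)

  φ-nonneg : ∀ r .{{_ : NonZero r}} q P {B} → B < 2 ^ P → + 0 ℤ.≤ φ r q P B
  φ-nonneg r q P B<X with P ≤? q + κ r
  ... | yes _ = ℤ.+≤+ z≤n
  ... | no _  = m+n≤o⇒+m≤+o-+n (βγ-nonneg r (ℕₚ.<⇒≤ B<X))

  φ-violator : ∀ r .{{_ : NonZero r}} q P {B} → 2 ^ P ≤ B → B < 2 * 2 ^ P → + (α * 2 ^ P) ℤ.≤ φ r q P B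
  φ-violator r q P X≤B B<2X with P ≤? q + κ r
  ... | yes _ = ℤ.+≤+ (ℕₚ.*-monoʳ-≤ α X≤B)
  ... | no _  = m+n≤o⇒+m≤+o-+n (βγ-violator r (ℕₚ.<⇒≤ B<2X))

  φ-high : ∀ r .{{_ : NonZero r}} q P {B} → ¬ (P ≤ q + κ r) → B < 2 ^ P →
           + ((α * (r ∸ 1) + 8) * 2 ^ P) ℤ.≤ φ r q P B
  φ-high r q P P≰ B<X with P ≤? q + κ r
  ... | yes P≤ = ⊥-elim (P≰ P≤)
  ... | no _   = m+n≤o⇒+m≤+o-+n (βγ-high r (ℕₚ.<⇒≤ B<X))

  φ-promote : ∀ r q P B → φ r q (suc P) B ℤ.- φ r q P B ℤ.≤ + promotionBound r q P
  φ-promote r q P B with suc P ≤? q + κ r | P ≤? q + κ r | q + κ r ≤? P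
  ... | yes _     | yes _   | _       = ℤₚ.≤-trans (ℤₚ.≤-reflexive (ℤₚ.+-inverseʳ (+ (α * B)))) (ℤ.+≤+ z≤n)
  ... | yes 1+P≤  | no P≰   | _       = ⊥-elim (P≰ (ℕₚ.≤-trans (ℕₚ.n≤1+n P) 1+P≤))
  ... | no 1+P≰   | _       | no ≰P   = ⊥-elim (1+P≰ (ℕₚ.≰⇒> ≰P))
  ... | no _      | yes _   | yes _   = ℤₚ.≤-trans (ℤₚ.≤-reflexive (drop (+ (β r * 2 ^ suc P)) (+ (γ r * B)) (+ (α * B))))
                                          (ℤₚ.≤-trans (ℤₚ.i≤j⇒i-k≤j (+ (γ r * B + α * B)) ℤₚ.≤-refl)
                                                      (ℤₚ.≤-reflexive (cong +_ (≡.sym (ℕₚ.*-identityʳ _)))))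
    where
    drop : ∀ a b c → a ℤ.- b ℤ.- c ≡ a ℤ.- (b ℤ.+ c)
    drop = solve-∀
  ... | no _      | no _    | yes _   = ℤₚ.≤-trans (ℤₚ.≤-reflexive (cancel (+ (β r * 2 ^ suc P)) (+ (γ r * B)) (+ (β r * 2 ^ P))))
                                          (ℤₚ.≤-trans (ℤₚ.i≤j⇒i-k≤j (+ (β r * 2 ^ P)) ℤₚ.≤-refl)
                                                      (ℤₚ.≤-reflexive (cong +_ (≡.sym (ℕₚ.*-identityʳ _)))))
    where
    cancel : ∀ a b c → (a ℤ.- b) ℤ.- (c ℤ.- b) ≡ a ℤ.- c
    cancel = solve-∀

  φ-raise-high : ∀ r q P B a → ¬ (P ≤ q + κ r) → φ r q P (B + a) ℤ.- φ r q P B ≡ ℤ.- + (γ r * a)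
  φ-raise-high r q P B a P≰ with P ≤? q + κ r
  ... | yes P≤ = ⊥-elim (P≰ P≤)
  ... | no _   = scaled-decrement (+ (β r * 2 ^ P)) (γ r) B a

  φ-raise : ∀ r q P B a → φ r q P (B + a) ℤ.- φ r q P B ℤ.≤ + (α * a)
  φ-raise r q P B a with P ≤? q + κ r
  ... | yes _ = ℤₚ.≤-reflexive (scaled-increment α B a)
  ... | no _  = ℤₚ.≤-trans (ℤₚ.≤-reflexive (scaled-decrement (+ (β r * 2 ^ P)) (γ r) B a)) ℤₚ.neg-≤-pos

  -- The expected potential gain of a fetch

  count-≤ : ∀ {p*} → Valid p* → ∀ m → count p* m ≤ 2 ^ m
  count-≤ {p*} (p*<w , |S|≡2^) m with m <? w
  ... | yes m<w = ℕₚ.≤-reflexive (≡.trans (≡.sym (length-chunk p* m)) (|S|≡2^ m m<w))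
  ... | no m≮w  = ℕₚ.≤-trans (ℕₚ.≤-reflexive (Σℕ.sum-ε allU (λ {u} _ → absent u))) z≤n
    where
    absent : ∀ u → 𝟙 (p* u ≟ m) ≡ 0
    absent u with p* u ≟ m
    ... | yes refl = ⊥-elim (m≮w (p*<w u))
    ... | no _     = refl

  countUpTo : Partitioning → ℕ → ℕ
  countUpTo p* j = ∑ℕ allU (λ u → 𝟙 (p* u ≤? j))

  countUpTo<2^[1+j] : ∀ {p*} → Valid p* → ∀ j → countUpTo p* j < 2 ^ suc j
  countUpTo<2^[1+j] {p*} v zero    = s≤s (ℕₚ.≤-trans (ℕₚ.≤-reflexive (Σℕ.sum-cong allU (λ {u} _ → ≤0⇔≡0 (p* u)))) (count-≤ v 0))
    where
    ≤0⇔≡0 : ∀ x → 𝟙 (x ≤? 0) ≡ 𝟙 (x ≟ 0)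
    ≤0⇔≡0 zero    = refl
    ≤0⇔≡0 (suc x) = refl
  countUpTo<2^[1+j] {p*} v (suc j) = begin-strict
    countUpTo p* (suc j)                ≡⟨ Σℕ.sum-cong allU (λ {u} _ → split (p* u)) ⟩
    ∑ℕ allU (λ u → 𝟙 (p* u ≤? j) + 𝟙 (p* u ≟ suc j)) ≡⟨ Σℕ.sum-∙ allU _ _ ⟩
    countUpTo p* j + count p* (suc j)    <⟨ ℕₚ.+-mono-<-≤ (countUpTo<2^[1+j] v j) (count-≤ v (suc j)) ⟩
    2 ^ suc j + 2 ^ suc j         ≡⟨ cong (_+_ (2 ^ suc j)) (≡.sym (ℕₚ.+-identityʳ (2 ^ suc j))) ⟩
    2 ^ suc (suc j)               ∎
    where
    open ℕₚ.≤-Reasoning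
    split : ∀ x → 𝟙 (x ≤? suc j) ≡ 𝟙 (x ≤? j) + 𝟙 (x ≟ suc j)
    split x with x ≤? suc j | x ≤? j | x ≟ suc j
    ... | yes _   | yes _   | no _      = refl
    ... | yes _   | yes x≤j | yes refl  = ⊥-elim (ℕₚ.<-irrefl refl x≤j)
    ... | yes _   | no _    | yes _     = refl
    ... | yes x≤  | no x≰j  | no x≢     = ⊥-elim (x≢ (ℕₚ.≤-antisym x≤ (ℕₚ.≰⇒> x≰j)))
    ... | no x≰   | yes x≤j | _         = ⊥-elim (x≰ (ℕₚ.m≤n⇒m≤1+n x≤j))
    ... | no x≰   | no _    | yes refl  = ⊥-elim (x≰ ℕₚ.≤-refl)
    ... | no _    | no _    | no _      = refl

  2^k*shifted-count≤2^[1+i] : ∀ {p*} → Valid p* → ∀ k i → 2 ^ k * ∑ℕ allU (λ u → 𝟙 (p* u + k ≤? i)) ≤ 2 ^ suc i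
  2^k*shifted-count≤2^[1+i] {p*} v k i with k ≤? i
  ... | no k≰i = ℕₚ.≤-trans (ℕₚ.≤-reflexive (≡.trans (cong (2 ^ k *_) (Σℕ.sum-ε allU (λ {u} _ → none u))) (ℕₚ.*-zeroʳ (2 ^ k)))) z≤n
    where
    none : ∀ u → 𝟙 (p* u + k ≤? i) ≡ 0
    none u with p* u + k ≤? i
    ... | yes ≤i = ⊥-elim (k≰i (ℕₚ.≤-trans (ℕₚ.m≤n+m k (p* u)) ≤i))
    ... | no _   = refl
  ... | yes k≤i = begin
    2 ^ k * ∑ℕ allU (λ u → 𝟙 (p* u + k ≤? i))
      ≤⟨ ℕₚ.*-monoʳ-≤ (2 ^ k) (ℕₚ.≤-trans (∑ℕ-mono allU shift) (ℕₚ.<⇒≤ (countUpTo<2^[1+j] v (i ∸ k)))) ⟩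
    2 ^ k * 2 ^ suc (i ∸ k)                    ≡⟨ ≡.sym (ℕₚ.^-distribˡ-+-* 2 k (suc (i ∸ k))) ⟩
    2 ^ (k + suc (i ∸ k))                      ≡⟨ cong (2 ^_) (≡.trans (ℕₚ.+-suc k (i ∸ k)) (cong suc (ℕₚ.m+[n∸m]≡n k≤i))) ⟩
    2 ^ suc i                                  ∎
    where
    open ℕₚ.≤-Reasoning
    shift : ∀ u → 𝟙 (p* u + k ≤? i) ≤ 𝟙 (p* u ≤? i ∸ k)
    shift u with p* u + k ≤? i | p* u ≤? i ∸ k
    ... | yes _ | yes _   = ℕₚ.≤-refl
    ... | yes ≤ | no ≰    = ⊥-elim (≰ (ℕₚ.m+n≤o⇒m≤o∸n (p* u) ≤))
    ... | no _  | _       = z≤n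

  chunk-promotionBound≤ : ∀ r {p*} p i → Valid p* →
                       ∑ℕ (chunk p i) (λ a → promotionBound r (p* a) (p a)) ≤ 2 ^ i * (4 * 2 ^ i)
  chunk-promotionBound≤ r {p*} p i v = begin
    ∑ℕ (chunk p i) (λ a → promotionBound r (p* a) (p a))
      ≤⟨ ∑ℕ-filter-≤ (λ u → p u ≟ i) allU (λ u pu≡i → ℕₚ.≤-reflexive (cong (promotionBound r (p* u)) pu≡i)) ⟩
    ∑ℕ allU (λ a → β r * 2 ^ suc i * 𝟙 (p* a + κ r ≤? i))  ≡⟨ ∑ℕ-*ˡ allU (β r * 2 ^ suc i) _ ⟩
    β r * 2 ^ suc i * C                    ≤⟨ ℕₚ.*-monoˡ-≤ C (ℕₚ.*-monoˡ-≤ (2 ^ suc i) (n≤2^⌈log₂n⌉ (β r))) ⟩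
    2 ^ κ r * 2 ^ suc i * C                ≡⟨ reorder (2 ^ κ r) (2 ^ suc i) C ⟩
    2 ^ suc i * (2 ^ κ r * C)              ≤⟨ ℕₚ.*-monoʳ-≤ (2 ^ suc i) (2^k*shifted-count≤2^[1+i] v (κ r) i) ⟩
    2 ^ suc i * 2 ^ suc i                  ≡⟨ square (2 ^ i) ⟩
    2 ^ i * (4 * 2 ^ i)                    ∎
    where
    open ℕₚ.≤-Reasoning
    C = ∑ℕ allU (λ a → 𝟙 (p* a + κ r ≤? i))
    reorder : ∀ a b c → a * b * c ≡ b * (a * c)
    reorder = ℕ-solve-∀
    square : ∀ x → (2 * x) * (2 * x) ≡ x * (4 * x)
    square = ℕ-solve-∀

  choices-𝔼≤ : ∀ {p} (f : U → ℕ) (B : ℕ → ℕ) → Valid p → (∀ i → ∑ℕ (chunk p i) f ≤ 2 ^ i * B i) →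
               ∀ k → k ≤ w → 𝔼≤ (choices p k) (λ as → + ∑ℕ as f) (+ ∑< k B)
  choices-𝔼≤ f B v chunk≤ zero    _   = 𝔼≤-return ℤₚ.≤-refl
  choices-𝔼≤ {p} f B v@(_ , |S|≡2^) chunk≤ (suc k) 1+k≤w =
    𝔼≤-bind (choices-Transversal p k)
      (λ as _ → 𝔼≤-bind (Always-uniform (chunk p k)) (λ _ _ → 𝔼≤-return ℤₚ.≤-refl)
                        (𝔼≤-shiftʳ (+ ∑ℕ as f) (𝔼≤-uniform {f = λ a → + f a} S≢[] average)))
      (𝔼≤-shiftˡ (+ B k) (choices-𝔼≤ f B v chunk≤ k (ℕₚ.<⇒≤ 1+k≤w)))
    where
    S≢[] : chunk p k ≢ []
    S≢[] S≡[] = ℕₚ.<-irrefl refl (subst (0 <_) (≡.trans (≡.sym (|S|≡2^ k 1+k≤w)) (cong length S≡[])) (ℕₚ.m^n>0 2 k))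
    average : ∑ℤ (chunk p k) (λ a → + f a) ℤ.≤ + length (chunk p k) ℤ.* + B k
    average = ℤₚ.≤-trans (ℤₚ.≤-reflexive (∑ℤ-pos (chunk p k) f))
              (ℤₚ.≤-trans (ℤ.+≤+ (chunk≤ k))
              (ℤₚ.≤-reflexive (≡.trans (ℤₚ.pos-* (2 ^ k) (B k)) (cong (λ n → + n ℤ.* + B k) (≡.sym (|S|≡2^ k 1+k≤w))))))

  promotions : ℕ → ℕ
  promotions ℓ = ∑< ℓ (λ i → 4 * 2 ^ i)

  moveCost+promotions≤ : ∀ ℓ → moveCost ℓ + promotions ℓ ≤ α * 2 ^ ℓ
  moveCost+promotions≤ zero    = z≤n
  moveCost+promotions≤ (suc ℓ) = ℕₚ.≤-trans (ℕₚ.m≤m+n _ 6) (ℕₚ.≤-reflexive (begin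
    moveCost (suc ℓ) + promotions (suc ℓ) + 6       ≡⟨ regroup X (sumPow (suc ℓ)) (promotions (suc ℓ)) ⟩
    X + (sumPow (suc ℓ) + 2) + (promotions (suc ℓ) + 4)
      ≡⟨ cong₂ (λ a b → X + a + b) (sumPow-geometric (suc ℓ)) (promotions-geometric (suc ℓ)) ⟩
    X + 2 * X + 4 * X                                ≡⟨ collect X ⟩
    α * X                                            ∎))
    where
    open ≡.≡-Reasoning
    X = 2 ^ suc ℓ
    regroup : ∀ x a b → x + a + b + 6 ≡ x + (a + 2) + (b + 4)
    regroup = ℕ-solve-∀
    collect : ∀ x → x + 2 * x + 4 * x ≡ 7 * x
    collect = ℕ-solve-∀
    sumPow-geometric : ∀ k → sumPow k + 2 ≡ 2 ^ suc k
    sumPow-geometric zero    = refl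
    sumPow-geometric (suc k) = ≡.trans (swap (sumPow k) (2 ^ suc k))
      (cong (_+_ (2 ^ suc k)) (≡.trans (sumPow-geometric k) (≡.sym (ℕₚ.+-identityʳ _))))
      where
      swap : ∀ a b → a + b + 2 ≡ b + (a + 2)
      swap = ℕ-solve-∀
    promotions-geometric : ∀ k → promotions k + 4 ≡ 4 * 2 ^ k
    promotions-geometric zero    = refl
    promotions-geometric (suc k) = ≡.trans (ℕₚ.+-assoc (4 * 2 ^ k) (promotions k) 4)
                                   (≡.trans (cong (_+_ (4 * 2 ^ k)) (promotions-geometric k)) (double (2 ^ k)))
      where
      double : ∀ x → 4 * x + 4 * x ≡ 4 * (2 * x)
      double = ℕ-solve-∀

  -- Budgets and the termination of the loop

  record Fetched (s : State) (z : U) (s' : State) : Set where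
    field
      valid     : Valid (part s')
      reset     : budget s' z ≡ 0
      demoted   : ∀ {u} → u ≢ z → part s u ≤ part s' u
      unchanged : ∀ {u} → u ≢ z → budget s' u ≡ budget s u

  fetch-Fetched : ∀ {p b} z → Valid p → Always (Fetched (p , b) z ∘ proj₁) (fetch (p , b) z)
  fetch-Fetched {p} {b} z v = Always-bind (choices-Transversal p (p z)) λ as tr → Always-return (record
    { valid     = Valid-movedPart v tr
    ; reset     = update-self b z 0
    ; demoted   = λ {u} u≢z → demoted u u≢z
    ; unchanged = update-other b 0
    })
    where
    demoted : ∀ {as} u → u ≢ z → p u ≤ movedPart p z as u
    demoted {as} u u≢z with toSum (u ∈? as)
    ... | inj₁ u∈as rewrite movedPart-chosen p u≢z u∈as = ℕₚ.n≤1+n (p u)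
    ... | inj₂ u∉as rewrite movedPart-other p u≢z u∉as = ℕₚ.≤-refl

  LoopInv : State → Set
  LoopInv (p , b) = Valid p × (∀ u → b u < 2 * 2 ^ p u)

  Settled : State → Set
  Settled (p , b) = Valid p × (∀ u → b u < 2 ^ p u)

  LoopInv-fetch : ∀ {s z s'} → Fetched s z s' → LoopInv s → LoopInv s'
  LoopInv-fetch {s} {z} {s'} f (_ , b<) = Fetched.valid f , bounded-budget
    where
    bounded-budget : ∀ u → budget s' u < 2 * 2 ^ part s' u
    bounded-budget u with toSum (u ≟ᶠ z)
    ... | inj₁ refl rewrite Fetched.reset f = ℕₚ.≤-trans (ℕₚ.m^n>0 2 (part s' u)) (ℕₚ.m≤m+n _ _)
    ... | inj₂ u≢z  rewrite Fetched.unchanged f u≢z =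
      ℕₚ.<-≤-trans (b< u) (ℕₚ.*-monoʳ-≤ 2 (ℕₚ.^-monoʳ-≤ 2 (Fetched.demoted f u≢z)))

  Settled-fetch : ∀ {s z s'} → Fetched s z s' → Settled s → ∀ u → budget s' u < 2 ^ part s' u
  Settled-fetch {s} {z} {s'} f (_ , b<) u with toSum (u ≟ᶠ z)
  ... | inj₁ refl rewrite Fetched.reset f = ℕₚ.m^n>0 2 (part s' u)
  ... | inj₂ u≢z  rewrite Fetched.unchanged f u≢z = ℕₚ.<-≤-trans (b< u) (ℕₚ.^-monoʳ-≤ 2 (Fetched.demoted f u≢z))

  violator-lookup : ∀ {p b v vs} i → violators (p , b) ≡ v ∷ vs →
                    2 ^ p (lookup (v ∷ vs) i) ≤ b (lookup (v ∷ vs) i)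
  violator-lookup {p} {b} i eq =
    proj₂ (∈-filter⁻ (λ z → 2 ^ p z ≤? b z) {xs = allU} (subst (_ ∈_) (≡.sym eq) (∈-lookup i)))

  no-violators : ∀ {p b} → violators (p , b) ≡ [] → ∀ u → b u < 2 ^ p u
  no-violators {p} {b} none u with 2 ^ p u ≤? b u
  ... | yes X≤b = case subst (u ∈_) none (∈-filter⁺ (λ z → 2 ^ p z ≤? b z) {xs = allU} (∈-allFin u) X≤b) of λ ()
  ... | no X≰b  = ℕₚ.≰⇒> X≰b

  fewer-violators : ∀ {p b z s'} → Fetched (p , b) z s' → 2 ^ p z ≤ b z →
                    length (violators s') < length (violators (p , b))
  fewer-violators {p} {b} {z} {s'} f X≤b = begin-strict
    length (violators s')                          <⟨ ℕₚ.n<1+n _ ⟩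
    suc (length (violators s'))                    ≡⟨ cong₂ _+_ (≡.sym (Σℕ.sum-indicator _≟ᶠ_ 1 allU-unique (∈-allFin z)))
                                                                (length-filter≡∑𝟙 (λ u → 2 ^ part s' u ≤? budget s' u) allU) ⟩
    ∑ℕ allU (Σℕ.indicator _≟ᶠ_ z 1) + ∑ℕ allU (λ u → 𝟙 (2 ^ part s' u ≤? budget s' u))
                                                   ≡⟨ ≡.sym (Σℕ.sum-∙ allU _ _) ⟩
    ∑ℕ allU (λ u → Σℕ.indicator _≟ᶠ_ z 1 u + 𝟙 (2 ^ part s' u ≤? budget s' u))
                                                   ≤⟨ ∑ℕ-mono allU pointwise ⟩
    ∑ℕ allU (λ u → 𝟙 (2 ^ p u ≤? b u))            ≡⟨ ≡.sym (length-filter≡∑𝟙 (λ u → 2 ^ p u ≤? b u) allU) ⟩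
    length (violators (p , b))                     ∎
    where
    open ℕₚ.≤-Reasoning
    pointwise : ∀ u → Σℕ.indicator _≟ᶠ_ z 1 u + 𝟙 (2 ^ part s' u ≤? budget s' u) ≤ 𝟙 (2 ^ p u ≤? b u)
    pointwise u with toSum (u ≟ᶠ z)
    ... | inj₁ refl rewrite Σℕ.indicator-self _≟ᶠ_ u 1 | Fetched.reset f with 2 ^ part s' u ≤? 0 | 2 ^ p u ≤? b u
    ...   | yes X≤0 | _      = ⊥-elim (ℕₚ.<-irrefl refl (ℕₚ.<-≤-trans (ℕₚ.m^n>0 2 (part s' u)) X≤0))
    ...   | no _    | yes _  = ℕₚ.≤-refl
    ...   | no _    | no X≰b = ⊥-elim (X≰b X≤b)
    pointwise u | inj₂ u≢z rewrite Σℕ.indicator-other _≟ᶠ_ 1 u≢z | Fetched.unchanged f u≢z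
      with 2 ^ part s' u ≤? b u | 2 ^ p u ≤? b u
    ...   | yes _  | yes _ = ℕₚ.≤-refl
    ...   | yes X'≤ | no X≰ = ⊥-elim (X≰ (ℕₚ.≤-trans (ℕₚ.^-monoʳ-≤ 2 (Fetched.demoted f u≢z)) X'≤))
    ...   | no _   | _     = z≤n

  loop-Settled : ∀ sel fuel s → LoopInv s → length (violators s) ≤ fuel → Always (Settled ∘ proj₁) (loop sel fuel s)
  loop-Settled sel zero    (p , b) (v , _) #violators≤0 with violators (p , b) in eq
  ... | []    = Always-return (v , no-violators {p} {b} eq)
  ... | _ ∷ _ = case #violators≤0 of λ ()
  loop-Settled sel (suc fuel) (p , b) inv #violators≤fuel with violators (p , b) in eq
  ... | []     = Always-return (proj₁ inv , no-violators {p} {b} eq)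
  ... | v ∷ vs = Always-bind (fetch-Fetched z (proj₁ inv)) λ sc f →
                 Always-bind (loop-Settled sel fuel (proj₁ sc) (LoopInv-fetch f inv) (fuel-left f)) λ _ settled →
                 Always-return settled
    where
    z = lookup (v ∷ vs) (sel (p , b) (length vs))
    fuel-left : ∀ {s'} → Fetched (p , b) z s' → length (violators s') ≤ fuel
    fuel-left f = ℕₚ.≤-pred (ℕₚ.≤-trans (fewer-violators f (violator-lookup {p} {b} (sel (p , b) (length vs)) eq))
                                       (ℕₚ.≤-trans (ℕₚ.≤-reflexive (cong length eq)) #violators≤fuel))

  raise : List U → U → ℕ → State → State
  raise R x a (p , b) = (p , addBudgets R x a b)

  LoopInv-raise : ∀ {p b R x s₁} → Settled (p , b) → IsMinimizer p R x → Fetched (p , b) x s₁ →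
                  LoopInv (raise R x (2 ^ p x) s₁)
  LoopInv-raise {p} {b} {R} {x} {s₁} settled (_ , x-min) f = Fetched.valid f , bounded-budget
    where
    b₁<X₁ : ∀ u → budget s₁ u < 2 ^ part s₁ u
    b₁<X₁ = Settled-fetch f settled
    bounded-budget : ∀ u → addBudgets R x (2 ^ p x) (budget s₁) u < 2 * 2 ^ part s₁ u
    bounded-budget u with toSum (u ∈? R) | toSum (u ≟ᶠ x)
    ... | inj₂ u∉R | _ rewrite addBudgets-unrequested {R} {x} (2 ^ p x) (budget s₁) u∉R =
      ℕₚ.<-≤-trans (b₁<X₁ u) (ℕₚ.m≤m+n _ _)
    ... | inj₁ _   | inj₁ refl rewrite addBudgets-chosen R u (2 ^ p u) (budget s₁) =
      ℕₚ.<-≤-trans (b₁<X₁ u) (ℕₚ.m≤m+n _ _)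
    ... | inj₁ u∈R | inj₂ u≢x rewrite addBudgets-requested (2 ^ p x) (budget s₁) u∈R u≢x =
      ℕₚ.+-mono-<-≤ (b₁<X₁ u) (ℕₚ.≤-trans (ℕₚ.^-monoʳ-≤ 2 (ℕₚ.≤-trans (x-min u u∈R) (Fetched.demoted f u≢x)))
                                          (ℕₚ.≤-reflexive (≡.sym (ℕₚ.+-identityʳ _))))

  process-Settled : ∀ sel {p b R x} → Settled (p , b) → IsMinimizer p R x → Always (Settled ∘ proj₁) (process sel (p , b) R x)
  process-Settled sel {p} {b} {R} {x} settled minimizer =
    Always-bind (fetch-Fetched x (proj₁ settled)) λ { (s₁ , _) f →
    Always-bind (loop-Settled sel (2 ^ w ∸ 1) (raise R x (2 ^ p x) s₁) (LoopInv-raise settled minimizer f)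
                              (few (raise R x (2 ^ p x) s₁))) λ _ settled' →
    Always-return settled' }
    where
    few : ∀ s → length (violators s) ≤ 2 ^ w ∸ 1
    few s = ℕₚ.≤-trans (Listₚ.length-filter _ allU) (ℕₚ.≤-reflexive (Listₚ.length-tabulate _))

  Reachable⇒Settled : ∀ {r s} → Reachable r s → Settled s
  Reachable⇒Settled (init p v) = v , λ u → ℕₚ.m^n>0 2 (p u)
  Reachable⇒Settled (step (p , b) R x sel s' c reach _ minimizer s'∈) =
    Always-⇒ (process-Settled sel (Reachable⇒Settled reach) minimizer) s'∈

  -- Amortized costs

  optAccess-attained : ∀ p* (R : List U) → R ≢ [] → ∃ λ y → y ∈ R × optAccess p* R ≡ 2 ^ p* y
  optAccess-attained p* []      R≢[] = ⊥-elim (R≢[] refl)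
  optAccess-attained p* (u ∷ R) _    with attained u R
    where
    attained : ∀ u (R : List U) → ∃ λ y → (y ≡ u ⊎ y ∈ R) × foldr (λ v m → 2 ^ p* v ⊓ m) (2 ^ p* u) R ≡ 2 ^ p* y
    attained u []      = u , inj₁ refl , refl
    attained u (v ∷ R) with attained u R
    ... | y , y∈ , eq with ℕₚ.⊓-sel (2 ^ p* v) (2 ^ p* y)
    ...   | inj₁ ≡v = v , inj₂ (here refl) , ≡.trans (cong (2 ^ p* v ⊓_) eq) ≡v
    ...   | inj₂ ≡y = y , map₂ there y∈ , ≡.trans (cong (2 ^ p* v ⊓_) eq) ≡y
  ... | y , inj₁ refl , eq = y , here refl , eq
  ... | y , inj₂ y∈R  , eq = y , there y∈R , eq

  8X+[nαX-αX]≡X+nαX : ∀ X n → + (8 * X) ℤ.+ (+ n ℤ.* + (α * X) ℤ.- + (α * X)) ≡ + (X + n * (α * X))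
  8X+[nαX-αX]≡X+nαX X n = ≡.trans (collect (+ X) (+ (α * X)) (+ n)) (cong (ℤ._+_ (+ X)) (≡.sym (ℤₚ.pos-* n (α * X))))
    where
    collect : ∀ a b m → a ℤ.+ b ℤ.+ (m ℤ.* b ℤ.- b) ≡ a ℤ.+ m ℤ.* b
    collect = solve-∀

  X+nαX≤[α[r-1]+8]X : ∀ r .{{_ : NonZero r}} X {n} → n ≤ r → X + n * (α * X) ≤ (α * (r ∸ 1) + 8) * X
  X+nαX≤[α[r-1]+8]X (suc r) X n≤r = ℕₚ.≤-trans (ℕₚ.+-monoʳ-≤ X (ℕₚ.*-monoˡ-≤ (α * X) n≤r)) (ℕₚ.≤-reflexive (expand r X))
    where
    expand : ∀ r X → X + (1 + r) * (7 * X) ≡ (7 * r + 8) * X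
    expand = ℕ-solve-∀

  X+nαX≤αX+γX : ∀ r .{{_ : NonZero r}} X {n} → n ≤ r → X + n * (α * X) ≤ α * X + γ r * X
  X+nαX≤αX+γX (suc r) X n≤r = ℕₚ.≤-trans (ℕₚ.+-monoʳ-≤ X (ℕₚ.*-monoˡ-≤ (α * X) n≤r))
                                          (ℕₚ.≤-reflexive (≡.trans (expand r X) (cong (λ g → 7 * X + g * X) (≡.sym (γ-suc r)))))
    where
    expand : ∀ r X → X + (1 + r) * (7 * X) ≡ 7 * X + (1 + 7 * r) * X
    expand = ℕ-solve-∀

  module Amortized (r : ℕ) {{_ : NonZero r}} (p* : Partitioning) (v* : Valid p*) where

    amortizedCost : State → State × ℕ → ℤ
    amortizedCost s₀ (s , c) = + c ℤ.+ (Φ r p* s ℤ.- Φ r p* s₀)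

    fetch-ΔΦ : ∀ {p b z as} → Transversal p (p z) as →
               Φ r p* (movedPart p z as , update b z 0) ℤ.- Φ r p* (p , b)
                 ℤ.≤ ℤ.- Φᵤ r p* (p , b) z ℤ.+ + ∑ℕ as (λ a → promotionBound r (p* a) (p a))
    fetch-ΔΦ {p} {b} {z} {as} tr = begin
      Φ r p* s' ℤ.- Φ r p* s              ≡⟨ ΔΦ≡∑ΔΦᵤ r p* s s' ⟩
      ∑ℤ allU Δ                           ≡⟨ Σℤ.sum-vanishing _≟ᶠ_ allU-unique (Transversal-unique-∷ tr) ⊆allU unmoved ⟩
      Δ z ℤ.+ ∑ℤ as Δ                     ≤⟨ ℤₚ.+-mono-≤ (ℤₚ.≤-reflexive fetched) (∑ℤ-mono-∈ as promoted) ⟩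
      ℤ.- Φᵤ r p* s z ℤ.+ ∑ℤ as (+_ ∘ prom) ≡⟨ cong (ℤ._+_ (ℤ.- Φᵤ r p* s z)) (∑ℤ-pos as prom) ⟩
      ℤ.- Φᵤ r p* s z ℤ.+ + ∑ℕ as prom    ∎
      where
      open ℤₚ.≤-Reasoning
      s = (p , b)
      s' = (movedPart p z as , update b z 0)
      prom : U → ℕ
      prom a = promotionBound r (p* a) (p a)
      Δ : U → ℤ
      Δ = ΔΦᵤ r p* s s'
      unmoved : ∀ {u} → u ∉ z ∷ as → Δ u ≡ + 0
      unmoved u∉ = ΔΦᵤ-unchanged r p* s s' (movedPart-other p (u∉ ∘ here) (u∉ ∘ there)) (update-other b 0 (u∉ ∘ here))
      fetched : Δ z ≡ ℤ.- Φᵤ r p* s z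
      fetched = ≡.trans (cong (ℤ._- Φᵤ r p* s z) (≡.trans (Φᵤ≡φ r p* (movedPart p z as) (update b z 0) z)
                  (≡.trans (cong₂ (φ r (p* z)) (movedPart-fetched p z as) (update-self b z 0)) (φ-fetched r (p* z)))))
                (ℤₚ.+-identityˡ _)
      promoted : ∀ {a} → a ∈ as → Δ a ℤ.≤ + prom a
      promoted {a} a∈as = ℤₚ.≤-trans
        (ℤₚ.≤-reflexive (≡.trans (ΔΦᵤ≡Δφ r p* s s' a)
          (cong₂ (λ P B → φ r (p* a) P B ℤ.- φ r (p* a) (p a) (b a))
                 (movedPart-chosen p (Transversal-≢ tr a∈as) a∈as) (update-other b 0 (Transversal-≢ tr a∈as)))))
        (φ-promote r (p* a) (p a) (b a))

    fetch-𝔼≤ : ∀ {p b} z → Valid p →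
               𝔼≤ (fetch (p , b) z) (amortizedCost (p , b)) (+ (α * 2 ^ p z) ℤ.- Φᵤ r p* (p , b) z)
    fetch-𝔼≤ {p} {b} z v@(p<w , _) = 𝔼≤-weaken total
      (𝔼≤-bind (choices-Transversal p (p z))
        (λ as tr → 𝔼≤-return (ℤₚ.+-monoʳ-≤ (+ moveCost (p z)) (fetch-ΔΦ tr)))
        (𝔼≤-shiftˡ (+ moveCost (p z)) (𝔼≤-shiftˡ (ℤ.- Φᵤ r p* (p , b) z)
          (choices-𝔼≤ (λ a → promotionBound r (p* a) (p a)) (λ i → 4 * 2 ^ i) v
                      (λ i → chunk-promotionBound≤ r p i v*) (p z) (ℕₚ.<⇒≤ (p<w z))))))
      where
      total : + moveCost (p z) ℤ.+ (ℤ.- Φᵤ r p* (p , b) z ℤ.+ + promotions (p z))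
                ℤ.≤ + (α * 2 ^ p z) ℤ.- Φᵤ r p* (p , b) z
      total = ℤₚ.≤-trans (ℤₚ.≤-reflexive (regroup (+ moveCost (p z)) (+ promotions (p z)) (Φᵤ r p* (p , b) z)))
                         (ℤₚ.+-monoˡ-≤ (ℤ.- Φᵤ r p* (p , b) z) (ℤ.+≤+ (moveCost+promotions≤ (p z))))
        where
        regroup : ∀ m t φ → m ℤ.+ (ℤ.- φ ℤ.+ t) ≡ (m ℤ.+ t) ℤ.- φ
        regroup = solve-∀

    amortizedCost-idle : ∀ s → amortizedCost s (s , 0) ≡ + 0
    amortizedCost-idle s = ≡.trans (ℤₚ.+-identityˡ _) (ℤₚ.+-inverseʳ (Φ r p* s))

    amortizedCost-∘ : ∀ s₀ s₁ c₁ s₂ c₂ → amortizedCost s₀ (s₂ , c₁ + c₂) ≡ amortizedCost s₀ (s₁ , c₁) ℤ.+ amortizedCost s₁ (s₂ , c₂)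
    amortizedCost-∘ s₀ s₁ c₁ s₂ c₂ =
      ≡.trans (cong (ℤ._+ (Φ r p* s₂ ℤ.- Φ r p* s₀)) (ℤₚ.pos-+ c₁ c₂)) (telescope (+ c₁) (+ c₂) (Φ r p* s₀) (Φ r p* s₁) (Φ r p* s₂))
      where
      telescope : ∀ c₁ c₂ Φ₀ Φ₁ Φ₂ → c₁ ℤ.+ c₂ ℤ.+ (Φ₂ ℤ.- Φ₀) ≡ c₁ ℤ.+ (Φ₁ ℤ.- Φ₀) ℤ.+ (c₂ ℤ.+ (Φ₂ ℤ.- Φ₁))
      telescope = solve-∀

    loop-𝔼≤ : ∀ sel fuel s → LoopInv s → 𝔼≤ (loop sel fuel s) (amortizedCost s) (+ 0)
    loop-𝔼≤ sel zero    s _ = 𝔼≤-return (ℤₚ.≤-reflexive (amortizedCost-idle s))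
    loop-𝔼≤ sel (suc fuel) (p , b) inv with violators (p , b) in eq
    ... | []     = 𝔼≤-return (ℤₚ.≤-reflexive (amortizedCost-idle (p , b)))
    ... | v ∷ vs = 𝔼≤-bind (fetch-Fetched z (proj₁ inv)) continue (𝔼≤-weaken pays (fetch-𝔼≤ z (proj₁ inv)))
      where
      z = lookup (v ∷ vs) (sel (p , b) (length vs))
      pays : + (α * 2 ^ p z) ℤ.- Φᵤ r p* (p , b) z ℤ.≤ + 0
      pays = ℤₚ.i≤j⇒i-j≤0 (subst (+ (α * 2 ^ p z) ℤ.≤_) (≡.sym (Φᵤ≡φ r p* p b z))
               (φ-violator r (p* z) (p z) (violator-lookup {p} {b} (sel (p , b) (length vs)) eq)
                           (proj₂ inv z)))
      continue : ∀ sc → Fetched (p , b) z (proj₁ sc) →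
                 𝔼≤ (loop sel fuel (proj₁ sc) >>= λ sc' → return (proj₁ sc' , proj₂ sc + proj₂ sc'))
                    (amortizedCost (p , b)) (amortizedCost (p , b) sc)
      continue (s₁ , c₁) f = 𝔼≤-map {t = λ sc' → (proj₁ sc' , c₁ + proj₂ sc')}
        (𝔼≤-cong (λ { (s₂ , c₂) → ≡.sym (amortizedCost-∘ (p , b) s₁ c₁ s₂ c₂) }) (ℤₚ.+-identityʳ _)
                 (𝔼≤-shiftˡ (amortizedCost (p , b) (s₁ , c₁)) (loop-𝔼≤ sel fuel s₁ (LoopInv-fetch f inv))))

    raise-ΔΦ : ∀ {R x a} s (g : U → ℤ) → Unique R → x ∈ R →
               (∀ {u} → u ∈ R → u ≢ x → φ r (p* u) (part s u) (budget s u + a) ℤ.- φ r (p* u) (part s u) (budget s u) ℤ.≤ g u) →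
               Φ r p* (raise R x a s) ℤ.- Φ r p* s ℤ.≤ ∑ℤ R g ℤ.- g x
    raise-ΔΦ {R} {x} {a} (p , b) g uniqR x∈R raised = begin
      Φ r p* s' ℤ.- Φ r p* s       ≡⟨ ΔΦ≡∑ΔΦᵤ r p* s s' ⟩
      ∑ℤ allU Δ                    ≡⟨ Σℤ.sum-vanishing _≟ᶠ_ allU-unique uniqR ⊆allU unrequested ⟩
      ∑ℤ R Δ                       ≤⟨ ∑ℤ-mono-∈ R requested ⟩
      ∑ℤ R (λ u → g u ℤ.- Σℤ.indicator _≟ᶠ_ x (g x) u) ≡⟨ ∑ℤ-- R g _ ⟩
      ∑ℤ R g ℤ.- ∑ℤ R (Σℤ.indicator _≟ᶠ_ x (g x))     ≡⟨ cong (ℤ._-_ (∑ℤ R g)) (Σℤ.sum-indicator _≟ᶠ_ (g x) uniqR x∈R) ⟩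
      ∑ℤ R g ℤ.- g x               ∎
      where
      open ℤₚ.≤-Reasoning
      s = (p , b)
      s' = raise R x a s
      Δ : U → ℤ
      Δ = ΔΦᵤ r p* s s'
      unrequested : ∀ {u} → u ∉ R → Δ u ≡ + 0
      unrequested u∉R = ΔΦᵤ-unchanged r p* s s' refl (addBudgets-unrequested a b u∉R)
      requested : ∀ {u} → u ∈ R → Δ u ℤ.≤ g u ℤ.- Σℤ.indicator _≟ᶠ_ x (g x) u
      requested {u} u∈R with toSum (u ≟ᶠ x)
      ... | inj₁ refl = ℤₚ.≤-reflexive (≡.trans (ΔΦᵤ-unchanged r p* s s' refl (addBudgets-chosen R u a b))
                          (≡.sym (≡.trans (cong (ℤ._-_ (g u)) (Σℤ.indicator-self _≟ᶠ_ u (g u))) (ℤₚ.+-inverseʳ (g u)))))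
      ... | inj₂ u≢x  = ℤₚ.≤-trans (ℤₚ.≤-reflexive (≡.trans (ΔΦᵤ≡Δφ r p* s s' u)
                            (cong (λ B → φ r (p* u) (p u) B ℤ.- φ r (p* u) (p u) (b u)) (addBudgets-requested a b u∈R u≢x))))
                        (ℤₚ.≤-trans (raised u∈R u≢x)
                          (ℤₚ.≤-reflexive (≡.sym (≡.trans (cong (ℤ._-_ (g u)) (Σℤ.indicator-other _≟ᶠ_ (g x) u≢x))
                                                          (ℤₚ.+-identityʳ (g u))))))

    process-𝔼≤ : ∀ sel {p b R x} → Settled (p , b) → IsMinimizer p R x → (G : ℤ) →
                 (∀ {s₁} → Fetched (p , b) x s₁ → Φ r p* (raise R x (2 ^ p x) s₁) ℤ.- Φ r p* s₁ ℤ.≤ G) →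
                 𝔼≤ (process sel (p , b) R x) (amortizedCost (p , b)) (+ (8 * 2 ^ p x) ℤ.+ G ℤ.- Φᵤ r p* (p , b) x)
    process-𝔼≤ sel {p} {b} {R} {x} settled minimizer G raise≤G =
      𝔼≤-bind (fetch-Fetched x (proj₁ settled)) continue
        (𝔼≤-cong (λ _ → refl) (regroup (+ X) G (+ (α * X)) (Φᵤ r p* (p , b) x))
                 (𝔼≤-shiftˡ (+ X ℤ.+ G) (fetch-𝔼≤ x (proj₁ settled))))
      where
      X = 2 ^ p x
      regroup : ∀ X G Y φ → X ℤ.+ G ℤ.+ (Y ℤ.- φ) ≡ X ℤ.+ Y ℤ.+ G ℤ.- φ
      regroup = solve-∀
      continue : ∀ sc → Fetched (p , b) x (proj₁ sc) →
                 𝔼≤ (loop sel (2 ^ w ∸ 1) (raise R x X (proj₁ sc)) >>= λ sc' → return (proj₁ sc' , X + proj₂ sc + proj₂ sc'))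
                    (amortizedCost (p , b)) (+ X ℤ.+ G ℤ.+ amortizedCost (p , b) sc)
      continue (s₁ , c₁) f = 𝔼≤-map {t = λ sc' → (proj₁ sc' , X + c₁ + proj₂ sc')}
        (𝔼≤-cong (λ { (s₂ , c₂) → split (+ X) (+ c₁) (+ c₂) Φ₀ Φ₁ Φ₁' (Φ r p* s₂) }) refl
        (𝔼≤-weaken (ℤₚ.≤-trans (ℤₚ.≤-reflexive (ℤₚ.+-identityʳ _)) (ℤₚ.≤-trans (ℤₚ.+-monoʳ-≤ (+ X ℤ.+ A) (raise≤G f))
                                 (ℤₚ.≤-reflexive (swap (+ X) A G))))
        (𝔼≤-shiftˡ (+ X ℤ.+ A ℤ.+ (Φ₁' ℤ.- Φ₁))
                   (loop-𝔼≤ sel (2 ^ w ∸ 1) s₁' (LoopInv-raise settled minimizer f)))))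
        where
        s₁' = raise R x X s₁
        Φ₀ = Φ r p* (p , b)
        Φ₁ = Φ r p* s₁
        Φ₁' = Φ r p* s₁'
        A = amortizedCost (p , b) (s₁ , c₁)
        swap : ∀ X A G → X ℤ.+ A ℤ.+ G ≡ X ℤ.+ G ℤ.+ A
        swap = solve-∀
        split : ∀ X c₁ c₂ Φ₀ Φ₁ Φ₁' Φ₂ →
                X ℤ.+ (c₁ ℤ.+ (Φ₁ ℤ.- Φ₀)) ℤ.+ (Φ₁' ℤ.- Φ₁) ℤ.+ (c₂ ℤ.+ (Φ₂ ℤ.- Φ₁')) ≡ X ℤ.+ c₁ ℤ.+ c₂ ℤ.+ (Φ₂ ℤ.- Φ₀)
        split = solve-∀

    Φᵤ-nonneg : ∀ {p b} → Settled (p , b) → ∀ u → + 0 ℤ.≤ Φᵤ r p* (p , b) u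
    Φᵤ-nonneg {p} {b} (_ , b<) u = subst (+ 0 ℤ.≤_) (≡.sym (Φᵤ≡φ r p* p b u)) (φ-nonneg r (p* u) (p u) (b< u))

    process-𝔼≤-α : ∀ sel {p b R x} → Settled (p , b) → Unique R → IsMinimizer p R x →
                   𝔼≤ (process sel (p , b) R x) (amortizedCost (p , b))
                      (+ (2 ^ p x + length R * (α * 2 ^ p x)) ℤ.- Φᵤ r p* (p , b) x)
    process-𝔼≤-α sel {p} {b} {R} {x} settled uniqR minimizer@(x∈R , _) =
      𝔼≤-cong (λ _ → refl) (cong (ℤ._- Φᵤ r p* (p , b) x) total) (process-𝔼≤ sel settled minimizer _ raised)
      where
      X = 2 ^ p x
      raised : ∀ {s₁} → Fetched (p , b) x s₁ →
               Φ r p* (raise R x X s₁) ℤ.- Φ r p* s₁ ℤ.≤ ∑ℤ R (λ _ → + (α * X)) ℤ.- + (α * X)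
      raised {s₁} _ = raise-ΔΦ s₁ (λ _ → + (α * X)) uniqR x∈R (λ {u} _ _ → φ-raise r (p* u) (part s₁ u) (budget s₁ u) X)
      total : + (8 * X) ℤ.+ (∑ℤ R (λ _ → + (α * X)) ℤ.- + (α * X)) ≡ + (X + length R * (α * X))
      total = ≡.trans (cong (λ t → + (8 * X) ℤ.+ (t ℤ.- + (α * X))) (∑ℤ-const R (+ (α * X)))) (8X+[nαX-αX]≡X+nαX X (length R))

    -- OPT's cheapest element y of R sits too high in LMA's partitioning, so raising b(y) releases γ·2^{p(x)}.
    raise-ΔΦ-released : ∀ {p b R x y s₁} → Unique R → x ∈ R → y ∈ R → y ≢ x → ¬ (p y ≤ p* y + κ r) →
                        Fetched (p , b) x s₁ →
                        Φ r p* (raise R x (2 ^ p x) s₁) ℤ.- Φ r p* s₁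
                          ℤ.≤ (+ length R ℤ.* + (α * 2 ^ p x) ℤ.- + (α * 2 ^ p x + γ r * 2 ^ p x)) ℤ.- + (α * 2 ^ p x)
    raise-ΔΦ-released {p} {b} {R} {x} {y} {s₁} uniqR x∈R y∈R y≢x high f =
      ℤₚ.≤-trans (raise-ΔΦ s₁ g uniqR x∈R bound) (ℤₚ.≤-reflexive (cong₂ ℤ._-_ ∑g gx))
      where
      X = 2 ^ p x
      released : U → ℤ
      released = Σℤ.indicator _≟ᶠ_ y (+ (α * X + γ r * X))
      g : U → ℤ
      g u = + (α * X) ℤ.- released u
      bound : ∀ {u} → u ∈ R → u ≢ x → φ r (p* u) (part s₁ u) (budget s₁ u + X) ℤ.- φ r (p* u) (part s₁ u) (budget s₁ u) ℤ.≤ g u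
      bound {u} _ u≢x with toSum (u ≟ᶠ y)
      ... | inj₁ refl = ℤₚ.≤-reflexive (≡.trans
                          (φ-raise-high r (p* u) (part s₁ u) (budget s₁ u) X (high ∘ ℕₚ.≤-trans (Fetched.demoted f u≢x)))
                          (≡.sym (≡.trans (cong (ℤ._-_ (+ (α * X))) (Σℤ.indicator-self _≟ᶠ_ u _)) (cancel (+ (α * X)) (+ (γ r * X))))))
        where
        cancel : ∀ a c → a ℤ.- (a ℤ.+ c) ≡ ℤ.- c
        cancel = solve-∀
      ... | inj₂ u≢y  = ℤₚ.≤-trans (φ-raise r (p* u) (part s₁ u) (budget s₁ u) X)
                          (ℤₚ.≤-reflexive (≡.sym (≡.trans (cong (ℤ._-_ (+ (α * X))) (Σℤ.indicator-other _≟ᶠ_ _ u≢y))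
                                                          (ℤₚ.+-identityʳ _))))
      ∑g : ∑ℤ R g ≡ + length R ℤ.* + (α * X) ℤ.- + (α * X + γ r * X)
      ∑g = ≡.trans (∑ℤ-- R (λ _ → + (α * X)) released)
                   (cong₂ ℤ._-_ (∑ℤ-const R (+ (α * X))) (Σℤ.sum-indicator _≟ᶠ_ _ uniqR y∈R))
      gx : g x ≡ + (α * X)
      gx = ≡.trans (cong (ℤ._-_ (+ (α * X))) (Σℤ.indicator-other _≟ᶠ_ _ (≡.≢-sym y≢x))) (ℤₚ.+-identityʳ _)

    process-𝔼≤-γ : ∀ sel {p b R x y} → Settled (p , b) → Unique R → IsMinimizer p R x →
                   y ∈ R → y ≢ x → ¬ (p y ≤ p* y + κ r) →
                   𝔼≤ (process sel (p , b) R x) (amortizedCost (p , b))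
                      (+ (2 ^ p x + length R * (α * 2 ^ p x)) ℤ.- + (α * 2 ^ p x + γ r * 2 ^ p x) ℤ.- Φᵤ r p* (p , b) x)
    process-𝔼≤-γ sel {p} {b} {R} {x} settled uniqR minimizer@(x∈R , _) y∈R y≢x high =
      𝔼≤-cong (λ _ → refl) total
        (process-𝔼≤ sel settled minimizer _ (raise-ΔΦ-released uniqR x∈R y∈R y≢x high))
      where
      X = 2 ^ p x
      total : + (8 * X) ℤ.+ ((+ length R ℤ.* + (α * X) ℤ.- + (α * X + γ r * X)) ℤ.- + (α * X)) ℤ.- Φᵤ r p* (p , b) x
                ≡ + (X + length R * (α * X)) ℤ.- + (α * X + γ r * X) ℤ.- Φᵤ r p* (p , b) x
      total = ≡.trans (collect (+ X) (+ (α * X)) (+ (γ r * X)) (+ length R) (Φᵤ r p* (p , b) x))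
                      (cong (λ t → + X ℤ.+ t ℤ.- + (α * X + γ r * X) ℤ.- Φᵤ r p* (p , b) x) (≡.sym (ℤₚ.pos-* (length R) (α * X))))
        where
        collect : ∀ a b c m φ → a ℤ.+ b ℤ.+ ((m ℤ.* b ℤ.- (b ℤ.+ c)) ℤ.- b) ℤ.- φ ≡ a ℤ.+ m ℤ.* b ℤ.- (b ℤ.+ c) ℤ.- φ
        collect = solve-∀

    access-≤-OPT : ∀ {p R x y} → IsMinimizer p R x → y ∈ R → p y ≤ p* y + κ r → optAccess p* R ≡ 2 ^ p* y →
                   2 ^ p x ≤ 2 ^ κ r * optAccess p* R
    access-≤-OPT {p} {R} {x} {y} (_ , x-min) y∈R low opt≡ = begin
      2 ^ p x                   ≤⟨ ℕₚ.^-monoʳ-≤ 2 (ℕₚ.≤-trans (x-min y y∈R) low) ⟩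
      2 ^ (p* y + κ r)          ≡⟨ ℕₚ.^-distribˡ-+-* 2 (p* y) (κ r) ⟩
      2 ^ p* y * 2 ^ κ r        ≡⟨ ℕₚ.*-comm (2 ^ p* y) (2 ^ κ r) ⟩
      2 ^ κ r * 2 ^ p* y        ≡⟨ cong (2 ^ κ r *_) (≡.sym opt≡) ⟩
      2 ^ κ r * optAccess p* R  ∎
      where open ℕₚ.≤-Reasoning

    process-𝔼≤-OPT : ∀ sel {p b R x} → Settled (p , b) → Request r R → IsMinimizer p R x →
                     𝔼≤ (process sel (p , b) R x) (amortizedCost (p , b))
                        (+ ((α * (r ∸ 1) + 8) * 2 ^ κ r * optAccess p* R))
    process-𝔼≤-OPT sel {p} {b} {R} {x} settled (uniqR , R≢[] , |R|≤r) minimizer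
      with optAccess-attained p* R R≢[]
    ... | y , y∈R , opt≡ with p y ≤? p* y + κ r | toSum (y ≟ᶠ x)
    ... | yes low  | _         = 𝔼≤-weaken
          (ℤₚ.≤-trans (ℤₚ.i≤j⇒i-k≤j _ {{ℤ.nonNegative (Φᵤ-nonneg settled x)}} ℤₚ.≤-refl)
          (ℤ.+≤+ (ℕₚ.≤-trans (X+nαX≤[α[r-1]+8]X r (2 ^ p x) |R|≤r)
                 (ℕₚ.≤-trans (ℕₚ.*-monoʳ-≤ (α * (r ∸ 1) + 8) (access-≤-OPT minimizer y∈R low opt≡))
                             (ℕₚ.≤-reflexive (≡.sym (ℕₚ.*-assoc (α * (r ∸ 1) + 8) (2 ^ κ r) (optAccess p* R))))))))
          (process-𝔼≤-α sel settled uniqR minimizer)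
    ... | no  high | inj₁ refl = 𝔼≤-weaken
          (ℤₚ.≤-trans (ℤₚ.i≤j⇒i-j≤0 (ℤₚ.≤-trans (ℤ.+≤+ (X+nαX≤[α[r-1]+8]X r (2 ^ p y) |R|≤r))
                                               (subst (_ ℤ.≤_) (≡.sym (Φᵤ≡φ r p* p b y))
                                                      (φ-high r (p* y) (p y) high (proj₂ settled y)))))
                      (ℤ.+≤+ z≤n))
          (process-𝔼≤-α sel settled uniqR minimizer)
    ... | no  high | inj₂ y≢x  = 𝔼≤-weaken
          (ℤₚ.≤-trans (ℤₚ.i≤j⇒i-k≤j _ {{ℤ.nonNegative (Φᵤ-nonneg settled x)}} ℤₚ.≤-refl)
          (ℤₚ.≤-trans (ℤₚ.i≤j⇒i-j≤0 (ℤ.+≤+ (X+nαX≤αX+γX r (2 ^ p x) |R|≤r))) (ℤ.+≤+ z≤n)))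
          (process-𝔼≤-γ sel settled uniqR minimizer y∈R y≢x high)

lemma7 : ∀ (w r : ℕ) (s : LMA.State w) (p* : LMA.Partitioning w) (R : LMA.List' w) (x : LMA.U w) (sel : LMA.Selector w) →
    LMA.Reachable w r s → LMA.Valid w p* → LMA.Request w r R → LMA.IsMinimizer w (LMA.part w s) R x →
    𝔼 (LMA.process w sel s R x) (λ { (s' , c) → + c ℤ.+ (LMA.Φ w r p* s' ℤ.- LMA.Φ w r p* s) })
    ℚ.≤ (+ ((LMA.α w * (r ∸ 1) + 8) * 2 ^ LMA.κ w r * LMA.optAccess w p* R) / 1)
lemma7 w zero    _ _  []      _ _ _ _ (_ , R≢[] , _)  _ = ⊥-elim (R≢[] refl)
lemma7 w zero    _ _  (_ ∷ _) _ _ _ _ (_ , _ , ())   _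
lemma7 w (suc r) (p , b) p* R x sel reach v* request minimizer =
  𝔼≤⇒𝔼 (process-𝔼≤-OPT sel (Reachable⇒Settled reach) request minimizer)
  where
  open Analysis w
  open Amortized (suc r) p* v*
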